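{- Let $\lambda=(\lambda_1,\dots,\lambda_k)$ be a composition of $n$ having at least one part greater than $1$, and let $\lambda_j$ be the rightmost part of $\lambda$ greater than $1$. Let $\mathcal{ST}(\lambda)=(\lambda_1,\dots,\lambda_{j-1},\lambda_j-1,1,\lambda_{j+1},\dots,\lambda_k)$ and $t=\lambda_1+\cdots+\lambda_j$. Then $C_{\mathcal{ST}(\lambda)}\subseteq C_\lambda$. Set $C^{(0)}_{\mathcal{ST}(\lambda)}:=C_{\mathcal{ST}(\lambda)}$, and for $1\le i\le k-j$ let $C^{(i)}_{\mathcal{ST}(\lambda)}$ be the set of permutations $\pi^{(i)}$, $\pi=\pi^{(0)}\in C_{\mathcal{ST}(\lambda)}$, where $\pi^{(i)}$ is obtained from $\pi^{(i-1)}$ by interchanging the entries in positions $t$ and $t+i$ of its one-line notation (so that $\pi^{(i)}=[\pi_1,\dots,\pi_{t-1},\pi_{t+i},\pi_t,\pi_{t+1},\dots,\pi_{t+i-1},\pi_{t+i+1},\dots,\pi_n]$). Then each $C^{(i)}_{\mathcal{ST}(\lambda)}$, $0\le i\le k-j$, is a subset of $C_\lambda$ which, as a subposet of the Bruhat-Chevalley order, is isomorphic to $C_{\mathcal{ST}(\lambda)}$, and $$C_\lambda=\bigcup_{i=0}^{k-j}C^{(i)}_{\mathcal{ST}(\lambda)}.$$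
   Context: $S_n$ is the symmetric group on $[n]$; permutations are written in one-line notation $[\pi_1,\dots,\pi_n]$ with $\pi_i=\pi(i)$. The standard cyclic form of $\pi\in S_n$ is its expression as a product of disjoint cycles, with cycles of length one NOT omitted, each cycle beginning with its smallest entry, and cycles ordered by increasing first entries; the composition type of $\pi$ is the sequence of cycle lengths in this order. $\Omega:S_n\to S_n$ sends $\pi$ to the permutation whose one-line notation is the word obtained by deleting the parentheses from the standard cyclic form of $\pi$. For $\lambda\vDash n$, $C_\lambda:=\Omega(A_\lambda)$ where $A_\lambda$ is the set of permutations of composition type $\lambda$. The Bruhat-Chevalley order on $S_n$ is the transitive closure of $x<y$ where $y$ is obtained from $x$ by swapping two entries $a_i<a_j$ at positions $i<j$ with $inv(y)=inv(x)+1$, where $inv(x)=|\{(i,j):i<j,\ x(i)>x(j)\}|$. -}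

module Defs where

open import Data.Nat using (ℕ; zero; suc; _+_; _∸_; _≤_; _<_; _<?_; _≡ᵇ_)
open import Data.Bool using (if_then_else_)
open import Data.List using (List; []; _∷_; map; concat; length; filter; upTo; _++_)
open import Data.Nat.ListAction using (sum)
open import Data.List.Relation.Unary.All using (All)
open import Data.List.Relation.Binary.Permutation.Propositional using (_↭_)
open import Data.List.Relation.Unary.Linked using (Linked)
open import Data.Product using (Σ; ∃; _×_)
open import Data.Empty using (⊥)
open import Relation.Binary.PropositionalEquality using (_≡_)
open import Relation.Binary.Construct.Closure.ReflexiveTransitive using (Star)

-- Permutations of [n] are represented by their one-line notation, a list of naturals.
-- [1..n]
oneTo : ℕ → List ℕ
oneTo n = map suc (upTo n)

IsPerm : ℕ → List ℕ → Set
IsPerm n w = w ↭ oneTo n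

-- ev w i = w_i (1-based); 0 if out of range
ev : List ℕ → ℕ → ℕ
ev [] _ = 0
ev (x ∷ xs) zero = 0
ev (x ∷ xs) (suc zero) = x
ev (x ∷ xs) (suc (suc k)) = ev xs (suc k)

Chain : List ℕ → ℕ → List ℕ → Set
Chain π f [] = ⊥
Chain π f (x ∷ []) = ev π x ≡ f
Chain π f (x ∷ y ∷ r) = (ev π x ≡ y) × Chain π f (y ∷ r)

CycleOf : List ℕ → List ℕ → Set
CycleOf π [] = ⊥
CycleOf π (x ∷ r) = Chain π x (x ∷ r) × All (x ≤_) r

heads : List (List ℕ) → List ℕ
heads [] = []
heads ([] ∷ cs) = heads cs
heads ((x ∷ _) ∷ cs) = x ∷ heads cs

-- cs is the standard cyclic form of π (fixed points included)
IsStdCycForm : List ℕ → List (List ℕ) → Set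
IsStdCycForm π cs =
  All (CycleOf π) cs × Linked _<_ (heads cs) × (concat cs ↭ oneTo (length π))

InC : List ℕ → List ℕ → Set
InC λ′ w = Σ (List ℕ) λ π → Σ (List (List ℕ)) λ cs →
  IsPerm (sum λ′) π × IsStdCycForm π cs × (map length cs ≡ λ′) × (concat cs ≡ w)

swap : List ℕ → ℕ → ℕ → List ℕ
swap w i j = map (λ k → ev w (τ k)) (oneTo (length w))
  where
  τ : ℕ → ℕ
  τ k = if k ≡ᵇ i then j else (if k ≡ᵇ j then i else k)

inv : List ℕ → ℕ
inv [] = 0
inv (x ∷ xs) = length (filter (λ y → y <? x) xs) + inv xs

BruhatStep : List ℕ → List ℕ → Set
BruhatStep x y = Σ ℕ λ i → Σ ℕ λ j →
  (1 ≤ i) × (i < j) × (j ≤ length x) × (ev x i < ev x j) ×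
  (y ≡ swap x i j) × (inv y ≡ suc (inv x))

_≤B_ : List ℕ → List ℕ → Set
_≤B_ = Star BruhatStep

iterSwap : ℕ → List ℕ → ℕ → List ℕ
iterSwap t π zero = π
iterSwap t π (suc i) = swap (iterSwap t π i) t (t + suc i)

InCi : List ℕ → ℕ → ℕ → List ℕ → Set
InCi stλ t i w = Σ (List ℕ) λ π → InC stλ π × (iterSwap t π i ≡ w)

ST : List ℕ → ℕ → List ℕ → List ℕ
ST α a β = α ++ (a ∸ 1) ∷ 1 ∷ β

BruhatIso : (List ℕ → Set) → (List ℕ → Set) → Set
BruhatIso P Q = Σ (List ℕ → List ℕ) λ f →
  (∀ x → P x → Q (f x)) ×
  (∀ x y → P x → P y → f x ≡ f y → x ≡ y) ×
  (∀ y → Q y → ∃ λ x → P x × (f x ≡ y)) ×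
  (∀ x y → P x → P y → (x ≤B y → f x ≤B f y) × (f x ≤B f y → x ≤B y))

module Submission where

-- The one-line word of a permutation in C_λ is the concatenation of the
-- cycles of its standard cyclic form, so the proof analyses such words.
-- Write λ = α ++ a ∷ β with a > 1 and β a list of ones, and t = sum α + a.
-- A word of C_ST(λ) reads  Q ++ c ++ X : Q holds the cycles of shape α, c the
-- cycle of length a - 1, and X the increasing list of the remaining fixed
-- points, so that X starts at position t.
--
--  * Order.  π^(i) rotates the letter at position t + i in front of the i
--    smaller letters before it.  Such rotations preserve and reflect the
--    Bruhat order on words with distinct letters; this follows from two
--    general facts: swapping any ascending pair of positions goes up in the
--    Bruhat order, and the lifting property for an adjacent ascent.
--  * Cycle surgery.  Moving the fixed point X_i to the end of the cycle c
--    gives a standard cyclic form of type λ whose word is π^(i), whence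
--    C^(i) ⊆ C_λ; conversely, releasing the last letter of the cycle of
--    length a in a form of type λ as a fixed point exhibits every word of
--    C_λ as some π^(i), whence C_λ = ⋃ C^(i).

open import Defs
open import Data.Nat using (ℕ; zero; suc; _+_; _∸_; _≤_; _<_; _<?_; _≡ᵇ_; _<ᵇ_; z≤n; s≤s)
open import Data.Nat.Properties
open import Data.Nat.ListAction using (sum)
open import Data.Nat.ListAction.Properties using (sum-++)
open import Data.Nat.Tactic.RingSolver using (solve-∀)
open import Data.Bool using (true; false; T; if_then_else_)
open import Data.List using (List; []; _∷_; [_]; map; concat; length; filter; upTo; applyUpTo; _++_)
open import Data.List.Properties
  using (length-map; length-++; ++-assoc; map-applyUpTo; length-applyUpTo; map-cong; filter-++; concat-++; map-++; ∷-injectiveˡ)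
open import Data.List.Membership.Propositional using (_∈_)
open import Data.List.Membership.Propositional.Properties using (∈-++⁺ˡ; ∈-++⁺ʳ; ∈-++⁻)
open import Data.List.Relation.Unary.Any using (here; there)
open import Data.List.Relation.Unary.All as All using (All; []; _∷_; tabulate; lookup)
open import Data.List.Relation.Unary.All.Properties as AllP using (++⁻ˡ; ++⁻ʳ; ++⁺; concat⁻; applyUpTo⁺₁)
open import Data.List.Relation.Unary.Linked as Linked using (Linked; []; [-]; _∷_)
import Data.List.Relation.Unary.Linked.Properties as LinkedP
open import Data.List.Relation.Unary.Unique.Propositional using (Unique)
open import Data.List.Relation.Unary.AllPairs using ([]; _∷_)
import Data.List.Relation.Unary.Unique.Propositional.Properties as UniqueP
open import Data.List.Relation.Binary.Permutation.Propositional
  using (_↭_; ↭-refl; ↭-sym; ↭-trans; ↭-swap; ↭-prep; ↭⇒↭ₛ)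
open import Data.List.Relation.Binary.Permutation.Propositional.Properties
  using (++⁺ˡ; shift; All-resp-↭; ↭-length; filter-↭)
import Data.List.Relation.Binary.Permutation.Setoid.Properties as PermSetoid
open import Data.Product using (Σ; ∃; _×_; _,_; proj₁; proj₂)
open import Data.Sum using (_⊎_; inj₁; inj₂)
open import Data.Unit using (⊤; tt)
open import Data.Empty using (⊥-elim)
open import Relation.Nullary using (¬_; Dec; yes; no)
open import Relation.Binary.Definitions using (tri<; tri≈; tri>)
open import Relation.Binary.PropositionalEquality
  using (_≡_; _≢_; refl; sym; trans; cong; cong₂; subst; subst₂; setoid; module ≡-Reasoning)
open import Relation.Binary.Construct.Closure.ReflexiveTransitive using (Star; ε; _◅_; _◅◅_)
open import Function using (_∘_; id)
open import Function.Bundles using (_⇔_; mk⇔; Equivalence)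
open import Function.Construct.Composition using (_⇔-∘_)

τ : ℕ → ℕ → ℕ → ℕ
τ i j k = if k ≡ᵇ i then j else (if k ≡ᵇ j then i else k)

≡ᵇ-refl : ∀ n → (n ≡ᵇ n) ≡ true
≡ᵇ-refl zero = refl
≡ᵇ-refl (suc n) = ≡ᵇ-refl n

≡ᵇ-distinct : ∀ m n → m ≢ n → (m ≡ᵇ n) ≡ false
≡ᵇ-distinct m n m≢n with m ≡ᵇ n in eq
... | true = ⊥-elim (m≢n (≡ᵇ⇒≡ m n (subst T (sym eq) tt)))
... | false = refl

τ-at-i : ∀ i j → τ i j i ≡ j
τ-at-i i j rewrite ≡ᵇ-refl i = refl

τ-at-j : ∀ i j → τ i j j ≡ i
τ-at-j i j with j ≡ᵇ i in eq
... | true = ≡ᵇ⇒≡ j i (subst T (sym eq) tt)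
... | false rewrite ≡ᵇ-refl j = refl

τ-elsewhere : ∀ i j k → k ≢ i → k ≢ j → τ i j k ≡ k
τ-elsewhere i j k k≢i k≢j rewrite ≡ᵇ-distinct k i k≢i | ≡ᵇ-distinct k j k≢j = refl

ev-zero : ∀ w → ev w 0 ≡ 0
ev-zero [] = refl
ev-zero (x ∷ w) = refl

ev-beyond : ∀ w k → length w < k → ev w k ≡ 0
ev-beyond [] k _ = refl
ev-beyond (x ∷ w) (suc zero) (s≤s ())
ev-beyond (x ∷ []) (suc (suc k)) _ = refl
ev-beyond (x ∷ y ∷ w) (suc (suc k)) (s≤s p) = ev-beyond (y ∷ w) (suc k) p

ev-tabulate : ∀ (f : ℕ → ℕ) n k → 1 ≤ k → k ≤ n → ev (map f (oneTo n)) k ≡ f k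
ev-tabulate f n (suc k) _ k≤n =
  trans (cong (λ l → ev l (suc k)) (trans (cong (map f) (map-applyUpTo id suc n)) (map-applyUpTo suc f n)))
        (ev-applyUpTo (f ∘ suc) n k k≤n)
  where
  ev-applyUpTo : ∀ (h : ℕ → ℕ) n k → k < n → ev (applyUpTo h n) (suc k) ≡ h k
  ev-applyUpTo h (suc n) zero _ = refl
  ev-applyUpTo h (suc (suc n)) (suc k) (s≤s p) = ev-applyUpTo (h ∘ suc) (suc n) k p

length-oneTo : ∀ n → length (oneTo n) ≡ n
length-oneTo n = trans (length-map suc (upTo n)) (length-applyUpTo id n)

length-swap : ∀ w i j → length (swap w i j) ≡ length w
length-swap w i j = trans (length-map _ (oneTo (length w))) (length-oneTo (length w))

ev-swap : ∀ w i j → 1 ≤ i → i ≤ length w → 1 ≤ j → j ≤ length w →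
          ∀ k → ev (swap w i j) k ≡ ev w (τ i j k)
ev-swap w i j 1≤i i≤∣w∣ 1≤j j≤∣w∣ zero =
  trans (ev-zero (swap w i j)) (sym (trans (cong (ev w) (τ-elsewhere i j 0 (0≢ 1≤i) (0≢ 1≤j))) (ev-zero w)))
  where
  0≢ : ∀ {m} → 1 ≤ m → 0 ≢ m
  0≢ 1≤m refl = ⊥-elim (1+n≰n 1≤m)
ev-swap w i j 1≤i i≤∣w∣ 1≤j j≤∣w∣ (suc k) with suc k ≤? length w
... | yes k≤∣w∣ = ev-tabulate (λ k → ev w (τ i j k)) (length w) (suc k) (s≤s z≤n) k≤∣w∣
... | no k≰∣w∣ =
  trans (ev-beyond (swap w i j) (suc k) (subst (_< suc k) (sym (length-swap w i j)) (≰⇒> k≰∣w∣)))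
        (sym (trans (cong (ev w) (τ-elsewhere i j (suc k) (outside i≤∣w∣) (outside j≤∣w∣)))
                    (ev-beyond w (suc k) (≰⇒> k≰∣w∣))))
  where
  outside : ∀ {m} → m ≤ length w → suc k ≢ m
  outside m≤∣w∣ refl = k≰∣w∣ m≤∣w∣

ev-ext : ∀ (A B : List ℕ) → length A ≡ length B → (∀ k → ev A k ≡ ev B k) → A ≡ B
ev-ext [] [] _ _ = refl
ev-ext (x ∷ A) (y ∷ B) ∣A∣≡∣B∣ A≗B = cong₂ _∷_ (A≗B 1) (ev-ext A B (suc-injective ∣A∣≡∣B∣) A≗B′)
  where
  A≗B′ : ∀ k → ev A k ≡ ev B k
  A≗B′ zero = trans (ev-zero A) (sym (ev-zero B))
  A≗B′ (suc k) = A≗B (suc (suc k))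

ev-at : ∀ P (x : ℕ) Q → ev (P ++ x ∷ Q) (suc (length P)) ≡ x
ev-at [] x Q = refl
ev-at (p ∷ P) x Q = ev-at P x Q

ev-replace : ∀ P (x y : ℕ) Q k → k ≢ suc (length P) → ev (P ++ x ∷ Q) k ≡ ev (P ++ y ∷ Q) k
ev-replace [] x y Q zero _ = refl
ev-replace [] x y Q (suc zero) k≢1 = ⊥-elim (k≢1 refl)
ev-replace [] x y Q (suc (suc k)) _ = refl
ev-replace (p ∷ P) x y Q zero _ = refl
ev-replace (p ∷ P) x y Q (suc zero) _ = refl
ev-replace (p ∷ P) x y Q (suc (suc k)) k≢ = ev-replace P x y Q (suc k) (k≢ ∘ cong suc)

ev-second : ∀ P (a : ℕ) M b S → ev (P ++ a ∷ M ++ b ∷ S) (suc (length (P ++ a ∷ M))) ≡ b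
ev-second P a M b S =
  trans (cong (λ l → ev l (suc (length (P ++ a ∷ M)))) (sym (++-assoc P (a ∷ M) (b ∷ S)))) (ev-at (P ++ a ∷ M) b S)

first<second : ∀ P (a : ℕ) M → suc (length P) < suc (length (P ++ a ∷ M))
first<second P a M = s≤s (subst (length P <_) (sym (length-++ P)) (m<m+n (length P) (s≤s z≤n)))

second≤length : ∀ P (a : ℕ) M b S → suc (length (P ++ a ∷ M)) ≤ length (P ++ a ∷ M ++ b ∷ S)
second≤length P a M b S =
  subst (suc (length (P ++ a ∷ M)) ≤_) (sym (trans (cong length (sym (++-assoc P (a ∷ M) (b ∷ S)))) (length-++ (P ++ a ∷ M))))
        (m<m+n (length (P ++ a ∷ M)) (s≤s z≤n))

swap-exchanges : ∀ P (a : ℕ) M b S →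
  swap (P ++ a ∷ M ++ b ∷ S) (suc (length P)) (suc (length (P ++ a ∷ M))) ≡ P ++ b ∷ M ++ a ∷ S
swap-exchanges P a M b S = sym (ev-ext exchanged swapped same-length same-entries)
  where
  w = P ++ a ∷ M ++ b ∷ S
  exchanged = P ++ b ∷ M ++ a ∷ S
  i = suc (length P)
  j = suc (length (P ++ a ∷ M))
  swapped = swap w i j
  j≤∣w∣ : j ≤ length w
  j≤∣w∣ = second≤length P a M b S
  ev-swapped : ∀ k → ev swapped k ≡ ev w (τ i j k)
  ev-swapped = ev-swap w i j (s≤s z≤n) (<⇒≤ (<-≤-trans (first<second P a M) j≤∣w∣)) (s≤s z≤n) j≤∣w∣
  ∣P++x∷M∣ : ∀ x → length (P ++ x ∷ M) ≡ length P + suc (length M)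
  ∣P++x∷M∣ x = length-++ P
  ∣exchange∣ : ∀ x y → length (P ++ x ∷ M ++ y ∷ S) ≡ length P + suc (length M + suc (length S))
  ∣exchange∣ x y = trans (length-++ P) (cong (λ z → length P + suc z) (length-++ M))
  same-length : length exchanged ≡ length swapped
  same-length = trans (∣exchange∣ b a) (sym (trans (length-swap w i j) (∣exchange∣ a b)))
  same-entries : ∀ k → ev exchanged k ≡ ev swapped k
  same-entries k with k ≟ i
  ... | yes refl =
    trans (ev-at P b (M ++ a ∷ S)) (sym (trans (ev-swapped i) (trans (cong (ev w) (τ-at-i i j)) (ev-second P a M b S))))
  ... | no k≢i with k ≟ j
  ...   | yes refl =
    trans (subst (λ z → ev exchanged (suc z) ≡ a) (trans (∣P++x∷M∣ b) (sym (∣P++x∷M∣ a))) (ev-second P b M a S))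
          (sym (trans (ev-swapped j) (trans (cong (ev w) (τ-at-j i j)) (ev-at P a (M ++ b ∷ S)))))
  ...   | no k≢j =
    trans (ev-replace P b a (M ++ a ∷ S) k k≢i)
      (trans (cong (λ l → ev l k) (sym (++-assoc P (a ∷ M) (a ∷ S))))
        (trans (ev-replace (P ++ a ∷ M) a b S k k≢j)
          (trans (cong (λ l → ev l k) (++-assoc P (a ∷ M) (b ∷ S)))
            (sym (trans (ev-swapped k) (cong (ev w) (τ-elsewhere i j k k≢i k≢j)))))))

τ-involutive : ∀ p q k → τ p q (τ p q k) ≡ k
τ-involutive p q k with k ≟ p
... | yes refl = trans (cong (τ k q) (τ-at-i k q)) (τ-at-j k q)
... | no k≢p with k ≟ q
...   | yes refl = trans (cong (τ p k) (τ-at-j p k)) (τ-at-i p k)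
...   | no k≢q = trans (cong (τ p q) (τ-elsewhere p q k k≢p k≢q)) (τ-elsewhere p q k k≢p k≢q)

τ-injective : ∀ p q {x y} → τ p q x ≡ τ p q y → x ≡ y
τ-injective p q {x} {y} eq = trans (sym (τ-involutive p q x)) (trans (cong (τ p q) eq) (τ-involutive p q y))

τ-conjugate : ∀ p q i j m → τ (τ p q i) (τ p q j) (τ p q m) ≡ τ p q (τ i j m)
τ-conjugate p q i j m with m ≟ i
... | yes refl = trans (τ-at-i (τ p q m) (τ p q j)) (sym (cong (τ p q) (τ-at-i m j)))
... | no m≢i with m ≟ j
...   | yes refl = trans (τ-at-j (τ p q i) (τ p q m)) (sym (cong (τ p q) (τ-at-j i m)))
...   | no m≢j =
  trans (τ-elsewhere (τ p q i) (τ p q j) (τ p q m) (m≢i ∘ τ-injective p q) (m≢j ∘ τ-injective p q))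
        (sym (cong (τ p q) (τ-elsewhere i j m m≢i m≢j)))

τ-symmetric : ∀ i j k → i ≢ j → τ i j k ≡ τ j i k
τ-symmetric i j k i≢j with k ≟ i
... | yes refl = trans (τ-at-i k j) (sym (τ-at-j j k))
... | no k≢i with k ≟ j
...   | yes refl = trans (τ-at-j i k) (sym (τ-at-i k i))
...   | no k≢j = trans (τ-elsewhere i j k k≢i k≢j) (sym (τ-elsewhere j i k k≢j k≢i))

τ-diagonal : ∀ i k → τ i i k ≡ k
τ-diagonal i k with k ≟ i
... | yes refl = τ-at-i k k
... | no k≢i = τ-elsewhere i i k k≢i k≢i

InRange : ℕ → ℕ → Set
InRange n k = (1 ≤ k) × (k ≤ n)

τ-in-range : ∀ n p q k → InRange n p → InRange n q → InRange n k → InRange n (τ p q k)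
τ-in-range n p q k p∈ q∈ k∈ with k ≟ p
... | yes refl = subst (InRange n) (sym (τ-at-i k q)) q∈
... | no k≢p with k ≟ q
...   | yes refl = subst (InRange n) (sym (τ-at-j p k)) p∈
...   | no k≢q = subst (InRange n) (sym (τ-elsewhere p q k k≢p k≢q)) k∈

split-at : ∀ (w : List ℕ) k → k < length w → ∃ λ P → ∃ λ x → ∃ λ Q → (w ≡ P ++ x ∷ Q) × (length P ≡ k)
split-at (x ∷ w) zero _ = [] , x , w , refl , refl
split-at (y ∷ w) (suc k) (s≤s k<∣w∣) with split-at w k k<∣w∣
... | P , x , Q , refl , refl = y ∷ P , x , Q , refl , refl

split-at-two : ∀ (w : List ℕ) i j → 1 ≤ i → i < j → j ≤ length w →
  ∃ λ P → ∃ λ a → ∃ λ M → ∃ λ b → ∃ λ S →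
    (w ≡ P ++ a ∷ M ++ b ∷ S) × (suc (length P) ≡ i) × (suc (length (P ++ a ∷ M)) ≡ j)
split-at-two w (suc i) (suc j) _ (s≤s i<j) j≤∣w∣
  with split-at w i (<-≤-trans (s≤s (<⇒≤ i<j)) j≤∣w∣)
... | P , a , Q , refl , refl with split-at Q (j ∸ suc (length P)) (∣Q∣-bound j≤∣w∣)
  where
  ∣Q∣-bound : suc j ≤ length (P ++ a ∷ Q) → j ∸ suc (length P) < length Q
  ∣Q∣-bound j≤ = subst (j ∸ suc (length P) <_) (m+n∸m≡n (length P) (length Q))
    (∸-monoˡ-< (subst (j <_) (trans (length-++ P) (+-suc (length P) (length Q))) j≤) i<j)
... | M , b , S , refl , ∣M∣ = P , a , M , b , S , refl , refl , cong suc ∣P++a∷M∣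
  where
  ∣P++a∷M∣ : length (P ++ a ∷ M) ≡ j
  ∣P++a∷M∣ = trans (length-++ P) (trans (cong (λ m → length P + suc m) ∣M∣) (trans (+-suc (length P) _) (m+[n∸m]≡n i<j)))

swap-involutive : ∀ w i j → 1 ≤ i → i ≤ length w → 1 ≤ j → j ≤ length w → swap (swap w i j) i j ≡ w
swap-involutive w i j 1≤i i≤∣w∣ 1≤j j≤∣w∣ =
  ev-ext _ _ (trans (length-swap (swap w i j) i j) (length-swap w i j)) same-entries
  where
  ∣sw∣ = length-swap w i j
  same-entries : ∀ k → ev (swap (swap w i j) i j) k ≡ ev w k
  same-entries k =
    trans (ev-swap (swap w i j) i j 1≤i (subst (i ≤_) (sym ∣sw∣) i≤∣w∣) 1≤j (subst (j ≤_) (sym ∣sw∣) j≤∣w∣) k)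
          (trans (ev-swap w i j 1≤i i≤∣w∣ 1≤j j≤∣w∣ (τ i j k)) (cong (ev w) (τ-involutive i j k)))

swap-symmetric : ∀ w i j → i ≢ j → swap w i j ≡ swap w j i
swap-symmetric w i j i≢j = map-cong (λ k → cong (ev w) (τ-symmetric i j k i≢j)) (oneTo (length w))

swap-diagonal : ∀ w i → 1 ≤ i → i ≤ length w → swap w i i ≡ w
swap-diagonal w i 1≤i i≤∣w∣ =
  ev-ext _ _ (length-swap w i i) (λ k → trans (ev-swap w i i 1≤i i≤∣w∣ 1≤i i≤∣w∣ k) (cong (ev w) (τ-diagonal i k)))

exchange-↭ : ∀ (a : ℕ) M b S → b ∷ M ++ a ∷ S ↭ a ∷ M ++ b ∷ S
exchange-↭ a M b S = ↭-trans (↭-prep b (shift a M S)) (↭-trans (↭-swap b a ↭-refl) (↭-prep a (↭-sym (shift b M S))))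

swap<-↭ : ∀ w i j → 1 ≤ i → i < j → j ≤ length w → swap w i j ↭ w
swap<-↭ w i j 1≤i i<j j≤∣w∣ with split-at-two w i j 1≤i i<j j≤∣w∣
... | P , a , M , b , S , refl , refl , refl =
  subst (_↭ P ++ a ∷ M ++ b ∷ S) (sym (swap-exchanges P a M b S)) (++⁺ˡ P (exchange-↭ a M b S))

swap-↭ : ∀ w i j → 1 ≤ i → i ≤ length w → 1 ≤ j → j ≤ length w → swap w i j ↭ w
swap-↭ w i j 1≤i i≤∣w∣ 1≤j j≤∣w∣ with <-cmp i j
... | tri< i<j _ _ = swap<-↭ w i j 1≤i i<j j≤∣w∣
... | tri≈ _ refl _ = subst (_↭ w) (sym (swap-diagonal w i 1≤i i≤∣w∣)) ↭-refl
... | tri> _ i≢j j<i = subst (_↭ w) (sym (swap-symmetric w i j i≢j)) (swap<-↭ w j i 1≤j j<i i≤∣w∣)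

Unique-↭ : ∀ {xs ys : List ℕ} → xs ↭ ys → Unique xs → Unique ys
Unique-↭ xs↭ys = PermSetoid.Unique-resp-↭ (setoid ℕ) (↭⇒↭ₛ xs↭ys)

below : ℕ → List ℕ → ℕ
below x L = length (filter (λ y → y <? x) L)

above : ℕ → List ℕ → ℕ
above x L = length (filter (λ y → x <? y) L)

below-++ : ∀ x A B → below x (A ++ B) ≡ below x A + below x B
below-++ x A B = trans (cong length (filter-++ (λ y → y <? x) A B)) (length-++ (filter (λ y → y <? x) A))

above-++ : ∀ x A B → above x (A ++ B) ≡ above x A + above x B
above-++ x A B = trans (cong length (filter-++ (λ y → x <? y) A B)) (length-++ (filter (λ y → x <? y) A))

below-↭ : ∀ x {A B} → A ↭ B → below x A ≡ below x B
below-↭ x A↭B = ↭-length (filter-↭ (λ y → y <? x) A↭B)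

below-above : ∀ x m → below m [ x ] ≡ above x [ m ]
below-above x m with x <ᵇ m
... | true = refl
... | false = refl

below-yes : ∀ x y → y < x → below x [ y ] ≡ 1
below-yes x y y<x with y <ᵇ x in eq
... | true = refl
... | false = ⊥-elim (subst T eq (<⇒<ᵇ y<x))

below-no : ∀ x y → ¬ (y < x) → below x [ y ] ≡ 0
below-no x y y≮x with y <ᵇ x in eq
... | true = ⊥-elim (y≮x (<ᵇ⇒< y x (subst T (sym eq) tt)))
... | false = refl

inv-insert : ∀ M x S → inv (M ++ x ∷ S) ≡ above x M + below x S + inv (M ++ S)
inv-insert [] x S = refl
inv-insert (m ∷ M) x S = begin
  below m (M ++ x ∷ S) + inv (M ++ x ∷ S)
    ≡⟨ cong₂ _+_ (trans (below-++ m M (x ∷ S)) (cong (below m M +_) (below-++ m [ x ] S))) (inv-insert M x S) ⟩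
  below m M + (below m [ x ] + below m S) + (above x M + below x S + inv (M ++ S))
    ≡⟨ cong (λ c → below m M + (c + below m S) + (above x M + below x S + inv (M ++ S))) (below-above x m) ⟩
  below m M + (above x [ m ] + below m S) + (above x M + below x S + inv (M ++ S))
    ≡⟨ regroup (below m M) (above x [ m ]) (below m S) (above x M) (below x S) (inv (M ++ S)) ⟩
  (above x [ m ] + above x M) + below x S + ((below m M + below m S) + inv (M ++ S))
    ≡⟨ sym (cong₂ (λ u v → u + below x S + (v + inv (M ++ S))) (above-++ x [ m ] M) (below-++ m M S)) ⟩
  above x (m ∷ M) + below x S + (below m (M ++ S) + inv (M ++ S)) ∎
  where
  open ≡-Reasoning
  regroup : ∀ bM c bS aM bS′ I → bM + (c + bS) + (aM + bS′ + I) ≡ (c + aM) + bS′ + ((bM + bS) + I)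
  regroup = solve-∀

Outside : ℕ → ℕ → ℕ → Set
Outside a b m = m < a ⊎ b < m

outside-counts : ∀ a b M → a < b → All (Outside a b) M → (below a M ≡ below b M) × (above a M ≡ above b M)
outside-counts a b [] a<b [] = refl , refl
outside-counts a b (m ∷ M) a<b (m∉ ∷ M∉) with outside-counts a b M a<b M∉
... | below≡ , above≡ =
  trans (below-++ a [ m ] M) (trans (cong₂ _+_ (single-below m∉) below≡) (sym (below-++ b [ m ] M))) ,
  trans (above-++ a [ m ] M) (trans (cong₂ _+_ (single-above m∉) above≡) (sym (above-++ b [ m ] M)))
  where
  single-below : Outside a b m → below a [ m ] ≡ below b [ m ]
  single-below (inj₁ m<a) = trans (below-yes a m m<a) (sym (below-yes b m (<-trans m<a a<b)))
  single-below (inj₂ b<m) = trans (below-no a m (λ m<a → <-asym b<m (<-trans m<a a<b))) (sym (below-no b m (<-asym b<m)))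
  single-above : Outside a b m → above a [ m ] ≡ above b [ m ]
  single-above (inj₁ m<a) =
    trans (sym (below-above a m)) (trans (below-no m a (<-asym m<a))
      (sym (trans (sym (below-above b m)) (below-no m b (λ b<m → <-asym m<a (<-trans a<b b<m))))))
  single-above (inj₂ b<m) =
    trans (sym (below-above a m)) (trans (below-yes m a (<-trans a<b b<m))
      (sym (trans (sym (below-above b m)) (below-yes m b b<m))))

inv-exchange : ∀ a b M S → a < b → All (Outside a b) M → inv (b ∷ M ++ a ∷ S) ≡ suc (inv (a ∷ M ++ b ∷ S))
inv-exchange a b M S a<b M∉ = begin
  below b (M ++ a ∷ S) + inv (M ++ a ∷ S)
    ≡⟨ cong₂ _+_ (trans (below-++ b M (a ∷ S)) (cong (below b M +_) (below-++ b [ a ] S))) (inv-insert M a S) ⟩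
  below b M + (below b [ a ] + below b S) + (above a M + below a S + inv (M ++ S))
    ≡⟨ cong₂ (λ c d → below b M + (c + below b S) + (d + below a S + inv (M ++ S))) (below-yes b a a<b) above≡ ⟩
  below b M + (1 + below b S) + (above b M + below a S + inv (M ++ S))
    ≡⟨ cong (λ c → c + (1 + below b S) + (above b M + below a S + inv (M ++ S))) (sym below≡) ⟩
  below a M + (1 + below b S) + (above b M + below a S + inv (M ++ S))
    ≡⟨ regroup (below a M) (below b S) (above b M) (below a S) (inv (M ++ S)) ⟩
  suc (below a M + (0 + below a S) + (above b M + below b S + inv (M ++ S)))
    ≡⟨ cong₂ (λ c d → suc (below a M + (c + below a S) + d)) (sym (below-no a b (<-asym a<b))) (sym (inv-insert M b S)) ⟩
  suc (below a M + (below a [ b ] + below a S) + inv (M ++ b ∷ S))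
    ≡⟨ cong (λ c → suc (c + inv (M ++ b ∷ S))) (sym (trans (below-++ a M (b ∷ S)) (cong (below a M +_) (below-++ a [ b ] S)))) ⟩
  suc (below a (M ++ b ∷ S) + inv (M ++ b ∷ S)) ∎
  where
  open ≡-Reasoning
  below≡ = proj₁ (outside-counts a b M a<b M∉)
  above≡ = proj₂ (outside-counts a b M a<b M∉)
  regroup : ∀ bM bS aM aS I → bM + (1 + bS) + (aM + aS + I) ≡ suc (bM + (0 + aS) + (aM + bS + I))
  regroup = solve-∀

inv-prefix : ∀ P L₁ L₂ → L₁ ↭ L₂ → inv L₂ ≡ suc (inv L₁) → inv (P ++ L₂) ≡ suc (inv (P ++ L₁))
inv-prefix [] L₁ L₂ _ eq = eq
inv-prefix (x ∷ P) L₁ L₂ L₁↭L₂ eq =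
  trans (cong₂ _+_ (sym (below-↭ x (++⁺ˡ P L₁↭L₂))) (inv-prefix P L₁ L₂ L₁↭L₂ eq))
        (+-suc (below x (P ++ L₁)) (inv (P ++ L₁)))

unique-suffix : ∀ (P : List ℕ) {L} → Unique (P ++ L) → Unique L
unique-suffix [] u = u
unique-suffix (x ∷ P) (_ ∷ u) = unique-suffix P u

unique-prefix : ∀ (A B : List ℕ) → Unique (A ++ B) → Unique A
unique-prefix [] B u = []
unique-prefix (x ∷ A) B (x∉ ∷ u) = ++⁻ˡ A x∉ ∷ unique-prefix A B u

unique-apart : ∀ (A B : List ℕ) → Unique (A ++ B) → ∀ {a b} → a ∈ A → b ∈ B → a ≢ b
unique-apart (x ∷ A) B (x∉ ∷ u) (here refl) b∈B = lookup (++⁻ʳ A x∉) b∈B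
unique-apart (x ∷ A) B (x∉ ∷ u) (there a∈A) b∈B = unique-apart A B u a∈A b∈B

unique-entries : ∀ w i j → Unique w → 1 ≤ i → i < j → j ≤ length w → ev w i ≢ ev w j
unique-entries w i j u 1≤i i<j j≤∣w∣ with split-at-two w i j 1≤i i<j j≤∣w∣
... | P , a , M , b , S , refl , refl , refl = λ a≡b →
  unique-apart [ a ] (M ++ b ∷ S) (unique-suffix P u) (here refl) (∈-++⁺ʳ M (here refl))
    (trans (sym (ev-at P a (M ++ b ∷ S))) (trans a≡b (ev-second P a M b S)))

exchange-step : ∀ P a M b S → a < b → All (Outside a b) M →
  BruhatStep (P ++ a ∷ M ++ b ∷ S) (P ++ b ∷ M ++ a ∷ S)
exchange-step P a M b S a<b M∉ =
  suc (length P) , suc (length (P ++ a ∷ M)) , s≤s z≤n , first<second P a M , second≤length P a M b S ,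
  subst₂ _<_ (sym (ev-at P a (M ++ b ∷ S))) (sym (ev-second P a M b S)) a<b ,
  sym (swap-exchanges P a M b S) ,
  inv-prefix P (a ∷ M ++ b ∷ S) (b ∷ M ++ a ∷ S) (↭-sym (exchange-↭ a M b S)) (inv-exchange a b M S a<b M∉)

Between : ℕ → ℕ → ℕ → Set
Between a b m = (a < m) × (m < b)

find-between : ∀ a b (M : List ℕ) →
  (∃ λ M₁ → ∃ λ m → ∃ λ M₂ → (M ≡ M₁ ++ m ∷ M₂) × Between a b m) ⊎ All (¬_ ∘ Between a b) M
find-between a b [] = inj₂ []
find-between a b (x ∷ M) with a <? x | x <? b | find-between a b M
... | yes a<x | yes x<b | _ = inj₁ ([] , x , M , refl , a<x , x<b)
... | _ | _ | inj₁ (M₁ , m , M₂ , refl , m∈) = inj₁ (x ∷ M₁ , m , M₂ , refl , m∈)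
... | yes _ | no x≮b | inj₂ none = inj₂ ((x≮b ∘ proj₂) ∷ none)
... | no a≮x | _ | inj₂ none = inj₂ ((a≮x ∘ proj₁) ∷ none)

outside-if-unique : ∀ P a M b S → Unique (P ++ a ∷ M ++ b ∷ S) → All (¬_ ∘ Between a b) M → All (Outside a b) M
outside-if-unique P a M b S u none = tabulate outside
  where
  u′ = unique-suffix P u
  outside : ∀ {m} → m ∈ M → Outside a b m
  outside {m} m∈M with <-cmp m a
  ... | tri< m<a _ _ = inj₁ m<a
  ... | tri≈ _ refl _ = ⊥-elim (unique-apart [ m ] (M ++ b ∷ S) u′ (here refl) (∈-++⁺ˡ m∈M) refl)
  ... | tri> _ _ a<m with <-cmp m b
  ...   | tri< m<b _ _ = ⊥-elim (lookup none m∈M (a<m , m<b))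
  ...   | tri≈ _ refl _ = ⊥-elim (unique-apart M (m ∷ S) (unique-suffix [ a ] u′) m∈M (here refl) refl)
  ...   | tri> _ _ b<m = inj₂ b<m

-- Exchanging an ascending pair a < b of a word with distinct letters goes up
-- in Bruhat order: if a letter m lies between them, split the exchange into
-- three shorter exchanges (a m), (a b), (m b); otherwise it is a covering step.
exchange-≤B : ∀ n P a M b S → length M < n → a < b → Unique (P ++ a ∷ M ++ b ∷ S) →
  (P ++ a ∷ M ++ b ∷ S) ≤B (P ++ b ∷ M ++ a ∷ S)
exchange-≤B (suc n) P a M b S (s≤s ∣M∣≤n) a<b u with find-between a b M
... | inj₂ none = exchange-step P a M b S a<b (outside-if-unique P a M b S u none) ◅ ε
... | inj₁ (M₁ , m , M₂ , refl , a<m , m<b) = step₁ ◅◅ (step₂ ◅◅ step₃)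
  where
  ∣M₁∣<n : length M₁ < n
  ∣M₁∣<n = <-≤-trans (subst (length M₁ <_) (sym (length-++ M₁)) (m<m+n (length M₁) (s≤s z≤n))) ∣M∣≤n
  ∣M₂∣<n : length M₂ < n
  ∣M₂∣<n = <-≤-trans (subst (length M₂ <_) (sym (length-++ M₁)) (m≤n+m (suc (length M₂)) (length M₁))) ∣M∣≤n
  M-split : ∀ x y → P ++ x ∷ (M₁ ++ m ∷ M₂) ++ y ∷ S ≡ P ++ x ∷ M₁ ++ m ∷ (M₂ ++ y ∷ S)
  M-split x y = cong (λ z → P ++ x ∷ z) (++-assoc M₁ (m ∷ M₂) (y ∷ S))
  w₁ = P ++ m ∷ M₁ ++ a ∷ M₂ ++ b ∷ S
  w₁-assoc : w₁ ≡ (P ++ m ∷ M₁) ++ a ∷ M₂ ++ b ∷ S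
  w₁-assoc = sym (++-assoc P (m ∷ M₁) (a ∷ M₂ ++ b ∷ S))
  w₂ = (P ++ m ∷ M₁) ++ b ∷ M₂ ++ a ∷ S
  w₂-assoc : w₂ ≡ P ++ m ∷ M₁ ++ b ∷ (M₂ ++ a ∷ S)
  w₂-assoc = ++-assoc P (m ∷ M₁) (b ∷ M₂ ++ a ∷ S)
  u₀ : Unique (P ++ a ∷ M₁ ++ m ∷ (M₂ ++ b ∷ S))
  u₀ = subst Unique (M-split a b) u
  u₁ : Unique ((P ++ m ∷ M₁) ++ a ∷ M₂ ++ b ∷ S)
  u₁ = subst Unique w₁-assoc (Unique-↭ (++⁺ˡ P (↭-sym (exchange-↭ a M₁ m (M₂ ++ b ∷ S)))) u₀)
  u₂ : Unique (P ++ m ∷ M₁ ++ b ∷ (M₂ ++ a ∷ S))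
  u₂ = subst Unique w₂-assoc (Unique-↭ (++⁺ˡ (P ++ m ∷ M₁) (↭-sym (exchange-↭ a M₂ b S))) u₁)
  step₁ : (P ++ a ∷ (M₁ ++ m ∷ M₂) ++ b ∷ S) ≤B w₁
  step₁ = subst (_≤B w₁) (sym (M-split a b)) (exchange-≤B n P a M₁ m (M₂ ++ b ∷ S) ∣M₁∣<n a<m u₀)
  step₂ : w₁ ≤B w₂
  step₂ = subst (_≤B w₂) (sym w₁-assoc) (exchange-≤B n (P ++ m ∷ M₁) a M₂ b S ∣M₂∣<n (<-trans a<m m<b) u₁)
  step₃ : w₂ ≤B (P ++ b ∷ (M₁ ++ m ∷ M₂) ++ a ∷ S)
  step₃ = subst₂ _≤B_ (sym w₂-assoc) (sym (M-split b a)) (exchange-≤B n P m M₁ b (M₂ ++ a ∷ S) ∣M₁∣<n m<b u₂)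

-- Swapping an ascending pair of positions: the generating relation of the
-- Bruhat order without the requirement that inv grows by exactly one.
AscentSwap : List ℕ → List ℕ → Set
AscentSwap x y = Σ ℕ λ i → Σ ℕ λ j →
  (1 ≤ i) × (i < j) × (j ≤ length x) × (ev x i < ev x j) × (y ≡ swap x i j)

_≤A_ : List ℕ → List ℕ → Set
_≤A_ = Star AscentSwap

AscentSwap-↭ : ∀ {x y} → AscentSwap x y → y ↭ x
AscentSwap-↭ {x} (i , j , 1≤i , i<j , j≤∣x∣ , _ , refl) = swap<-↭ x i j 1≤i i<j j≤∣x∣

AscentSwap-length : ∀ {x y} → AscentSwap x y → length y ≡ length x
AscentSwap-length {x} (i , j , _ , _ , _ , _ , refl) = length-swap x i j

-- On words with distinct letters the two closures coincide.
≤B⇒≤A : ∀ {x y} → x ≤B y → x ≤A y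
≤B⇒≤A ε = ε
≤B⇒≤A ((i , j , 1≤i , i<j , j≤ , asc , eq , _) ◅ x≤y) = (i , j , 1≤i , i<j , j≤ , asc , eq) ◅ ≤B⇒≤A x≤y

AscentSwap⇒≤B : ∀ {x y} → Unique x → AscentSwap x y → x ≤B y
AscentSwap⇒≤B {x} u (i , j , 1≤i , i<j , j≤∣x∣ , asc , refl) with split-at-two x i j 1≤i i<j j≤∣x∣
... | P , a , M , b , S , refl , refl , refl =
  subst ((P ++ a ∷ M ++ b ∷ S) ≤B_) (sym (swap-exchanges P a M b S))
    (exchange-≤B (suc (length M)) P a M b S ≤-refl (subst₂ _<_ (ev-at P a (M ++ b ∷ S)) (ev-second P a M b S) asc) u)

≤A⇒≤B : ∀ {x y} → Unique x → x ≤A y → x ≤B y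
≤A⇒≤B u ε = ε
≤A⇒≤B u (s ◅ x≤y) = AscentSwap⇒≤B u s ◅◅ ≤A⇒≤B (Unique-↭ (↭-sym (AscentSwap-↭ s)) u) x≤y

-- The lifting property for an adjacent pair of positions p, p + 1: on words
-- with distinct letters that both ascend at p, swapping the pair preserves
-- and reflects the order.  The proof goes through the maps lower/upper,
-- which pick the smaller/larger of w and its swap; both are monotone.
module Lifting (p : ℕ) (1≤p : 1 ≤ p) where

  σ : ℕ → ℕ
  σ = τ p (suc p)

  sw : List ℕ → List ℕ
  sw w = swap w p (suc p)

  Ascent : List ℕ → Set
  Ascent w = ev w p < ev w (suc p)

  lowerBy upperBy : (w : List ℕ) → Dec (Ascent w) → List ℕ
  lowerBy w (yes _) = w
  lowerBy w (no _) = sw w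
  upperBy w (yes _) = sw w
  upperBy w (no _) = w

  lower upper : List ℕ → List ℕ
  lower w = lowerBy w (ev w p <? ev w (suc p))
  upper w = upperBy w (ev w p <? ev w (suc p))

  σ-involutive : ∀ k → σ (σ k) ≡ k
  σ-involutive = τ-involutive p (suc p)

  σ-at-p : σ p ≡ suc p
  σ-at-p = τ-at-i p (suc p)

  σ-at-p+1 : σ (suc p) ≡ p
  σ-at-p+1 = τ-at-j p (suc p)

  σ-fixes : ∀ k → k ≢ p → k ≢ suc p → σ k ≡ k
  σ-fixes = τ-elsewhere p (suc p)

  σ-monotone : ∀ i j → i < j → ¬ (i ≡ p × j ≡ suc p) → σ i < σ j
  σ-monotone i j i<j not-pair with i ≟ p
  ... | yes refl = subst₂ _<_ (sym σ-at-p) (sym (σ-fixes j (λ { refl → <-irrefl refl i<j }) j≢p+1)) (≤∧≢⇒< i<j (j≢p+1 ∘ sym))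
    where
    j≢p+1 : j ≢ suc p
    j≢p+1 j≡p+1 = not-pair (refl , j≡p+1)
  ... | no i≢p with i ≟ suc p
  ...   | yes refl = subst₂ _<_ (sym σ-at-p+1) (sym (σ-fixes j j≢p (λ { refl → <-irrefl refl i<j }))) (<-trans (n<1+n p) i<j)
    where
    j≢p : j ≢ p
    j≢p refl = <-asym i<j (n<1+n p)
  ...   | no i≢p+1 with j ≟ p | j ≟ suc p
  ...     | yes refl | _ = subst₂ _<_ (sym (σ-fixes i i≢p i≢p+1)) (sym σ-at-p) (<-trans i<j (n<1+n p))
  ...     | no _ | yes refl = subst₂ _<_ (sym (σ-fixes i i≢p i≢p+1)) (sym σ-at-p+1) (≤∧≢⇒< (≤-pred i<j) i≢p)
  ...     | no j≢p | no j≢p+1 = subst₂ _<_ (sym (σ-fixes i i≢p i≢p+1)) (sym (σ-fixes j j≢p j≢p+1)) i<j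

  module _ (w : List ℕ) (p+1≤∣w∣ : suc p ≤ length w) where

    ev-sw : ∀ k → ev (sw w) k ≡ ev w (σ k)
    ev-sw = ev-swap w p (suc p) 1≤p (≤-trans (n≤1+n p) p+1≤∣w∣) (s≤s z≤n) p+1≤∣w∣

    sw-involutive : sw (sw w) ≡ w
    sw-involutive = swap-involutive w p (suc p) 1≤p (≤-trans (n≤1+n p) p+1≤∣w∣) (s≤s z≤n) p+1≤∣w∣

    ascent-step : Ascent w → AscentSwap w (sw w)
    ascent-step asc = p , suc p , 1≤p , ≤-refl , p+1≤∣w∣ , asc , refl

    sw-ascent : Ascent (sw w) → ¬ Ascent w
    sw-ascent asc′ asc = <-asym asc (subst₂ _<_ (trans (ev-sw p) (cong (ev w) (τ-at-i p (suc p))))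
                                                (trans (ev-sw (suc p)) (cong (ev w) (τ-at-j p (suc p)))) asc′)

    descent-step : Unique w → ¬ Ascent w → AscentSwap (sw w) w
    descent-step u ¬asc =
      p , suc p , 1≤p , ≤-refl , subst (suc p ≤_) (sym (length-swap w p (suc p))) p+1≤∣w∣ ,
      subst₂ _<_ (sym (trans (ev-sw p) (cong (ev w) (τ-at-i p (suc p))))) (sym (trans (ev-sw (suc p)) (cong (ev w) (τ-at-j p (suc p)))))
        (≤∧≢⇒< (≮⇒≥ ¬asc) (λ e → unique-entries w p (suc p) u 1≤p ≤-refl p+1≤∣w∣ (sym e))) ,
      sym sw-involutive

  conjugate-step : ∀ u → suc p ≤ length u → ∀ i j → 1 ≤ i → i < j → j ≤ length u → ev u i < ev u j →
    ¬ (i ≡ p × j ≡ suc p) → AscentSwap (sw u) (sw (swap u i j))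
  conjugate-step u p+1≤∣u∣ i j 1≤i i<j j≤∣u∣ asc not-pair =
    σ i , σ j , proj₁ (σ-in-range i i∈) , σ-monotone i j i<j not-pair , subst (σ j ≤_) (sym ∣sw∣) (proj₂ (σ-in-range j j∈)) ,
    subst₂ _<_ (sym (trans (ev-sw u p+1≤∣u∣ (σ i)) (cong (ev u) (σ-involutive i))))
               (sym (trans (ev-sw u p+1≤∣u∣ (σ j)) (cong (ev u) (σ-involutive j)))) asc ,
    ev-ext _ _ (trans (length-swap v p (suc p)) (trans (length-swap u i j) (sym (trans (length-swap (sw u) (σ i) (σ j)) ∣sw∣))))
               same-entries
    where
    v = swap u i j
    i∈ : InRange (length u) i
    i∈ = 1≤i , ≤-trans (<⇒≤ i<j) j≤∣u∣
    j∈ : InRange (length u) j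
    j∈ = ≤-trans 1≤i (<⇒≤ i<j) , j≤∣u∣
    ∣sw∣ : length (sw u) ≡ length u
    ∣sw∣ = length-swap u p (suc p)
    σ-in-range : ∀ k → InRange (length u) k → InRange (length u) (σ k)
    σ-in-range k = τ-in-range (length u) p (suc p) k (1≤p , ≤-trans (n≤1+n p) p+1≤∣u∣) (s≤s z≤n , p+1≤∣u∣)
    in-sw : ∀ k → InRange (length u) k → InRange (length (sw u)) (σ k)
    in-sw k k∈ = proj₁ (σ-in-range k k∈) , subst (σ k ≤_) (sym ∣sw∣) (proj₂ (σ-in-range k k∈))
    conj : ∀ k → σ (τ (σ i) (σ j) k) ≡ τ i j (σ k)
    conj k = trans (cong σ (trans (cong (τ (σ i) (σ j)) (sym (σ-involutive k))) (τ-conjugate p (suc p) i j (σ k)))) (σ-involutive _)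
    same-entries : ∀ k → ev (sw v) k ≡ ev (swap (sw u) (σ i) (σ j)) k
    same-entries k =
      trans (ev-sw v (subst (suc p ≤_) (sym (length-swap u i j)) p+1≤∣u∣) k)
        (trans (ev-swap u i j 1≤i (proj₂ i∈) (proj₁ j∈) j≤∣u∣ (σ k))
          (sym (trans (ev-swap (sw u) (σ i) (σ j) (proj₁ (in-sw i i∈)) (proj₂ (in-sw i i∈))
                                                  (proj₁ (in-sw j j∈)) (proj₂ (in-sw j j∈)) k)
                      (trans (ev-sw u p+1≤∣u∣ _) (cong (ev u) (conj k))))))

  monotone-other : ∀ u → suc p ≤ length u → Unique u → ∀ i j → 1 ≤ i → i < j → j ≤ length u → ev u i < ev u j →
    ¬ (i ≡ p × j ≡ suc p) → (lower u ≤A lower (swap u i j)) × (upper u ≤A upper (swap u i j))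
  monotone-other u p+1≤∣u∣ u-unique i j 1≤i i<j j≤∣u∣ asc not-pair
    with ev u p <? ev u (suc p) | ev (swap u i j) p <? ev (swap u i j) (suc p)
  ... | yes _ | yes _ = (step ◅ ε) , (conj ◅ ε)
    where
    step : AscentSwap u (swap u i j)
    step = i , j , 1≤i , i<j , j≤∣u∣ , asc , refl
    conj = conjugate-step u p+1≤∣u∣ i j 1≤i i<j j≤∣u∣ asc not-pair
  ... | no _ | no _ = (conj ◅ ε) , (step ◅ ε)
    where
    step : AscentSwap u (swap u i j)
    step = i , j , 1≤i , i<j , j≤∣u∣ , asc , refl
    conj = conjugate-step u p+1≤∣u∣ i j 1≤i i<j j≤∣u∣ asc not-pair
  ... | yes asc-u | no ¬asc-v = (ascent-step u p+1≤∣u∣ asc-u ◅ conj ◅ ε) , (conj ◅ descent-step v p+1≤∣v∣ v-unique ¬asc-v ◅ ε)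
    where
    step : AscentSwap u (swap u i j)
    step = i , j , 1≤i , i<j , j≤∣u∣ , asc , refl
    conj = conjugate-step u p+1≤∣u∣ i j 1≤i i<j j≤∣u∣ asc not-pair
    v = swap u i j
    p+1≤∣v∣ : suc p ≤ length v
    p+1≤∣v∣ = subst (suc p ≤_) (sym (length-swap u i j)) p+1≤∣u∣
    v-unique : Unique v
    v-unique = Unique-↭ (↭-sym (AscentSwap-↭ step)) u-unique
  ... | no ¬asc-u | yes asc-v = (descent-step u p+1≤∣u∣ u-unique ¬asc-u ◅ step ◅ ε) , (step ◅ ascent-step v p+1≤∣v∣ asc-v ◅ ε)
    where
    step : AscentSwap u (swap u i j)
    step = i , j , 1≤i , i<j , j≤∣u∣ , asc , refl
    v = swap u i j
    p+1≤∣v∣ : suc p ≤ length v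
    p+1≤∣v∣ = subst (suc p ≤_) (sym (length-swap u i j)) p+1≤∣u∣

  monotone-step : ∀ u v → Unique u → suc p ≤ length u → AscentSwap u v → (lower u ≤A lower v) × (upper u ≤A upper v)
  monotone-step u v u-unique p+1≤∣u∣ (i , j , 1≤i , i<j , j≤∣u∣ , asc , refl) with i ≟ p | j ≟ suc p
  ... | yes refl | yes refl = the-pair
    where
    the-pair : (lower u ≤A lower (sw u)) × (upper u ≤A upper (sw u))
    the-pair with ev u p <? ev u (suc p) | ev (sw u) p <? ev (sw u) (suc p)
    ... | yes asc-u | yes asc-sw = ⊥-elim (sw-ascent u p+1≤∣u∣ asc-sw asc-u)
    ... | yes _ | no _ = subst (u ≤A_) (sym (sw-involutive u p+1≤∣u∣)) ε , ε
    ... | no ¬asc | _ = ⊥-elim (¬asc asc)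
  ... | yes refl | no j≢ = monotone-other u p+1≤∣u∣ u-unique i j 1≤i i<j j≤∣u∣ asc (j≢ ∘ proj₂)
  ... | no i≢ | _ = monotone-other u p+1≤∣u∣ u-unique i j 1≤i i<j j≤∣u∣ asc (i≢ ∘ proj₁)

  monotone : ∀ u v → Unique u → suc p ≤ length u → u ≤A v → (lower u ≤A lower v) × (upper u ≤A upper v)
  monotone u .u _ _ ε = ε , ε
  monotone u v u-unique p+1≤∣u∣ (_◅_ {j = w} s w≤v)
    with monotone-step u w u-unique p+1≤∣u∣ s
       | monotone w v (Unique-↭ (↭-sym (AscentSwap-↭ {u} {w} s)) u-unique)
                      (subst (suc p ≤_) (sym (AscentSwap-length {u} {w} s)) p+1≤∣u∣) w≤v
  ... | lower₁ , upper₁ | lower₂ , upper₂ = (lower₁ ◅◅ lower₂) , (upper₁ ◅◅ upper₂)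

  lower-descent : ∀ w → ¬ Ascent w → lower w ≡ sw w
  lower-descent w ¬asc with ev w p <? ev w (suc p)
  ... | yes asc = ⊥-elim (¬asc asc)
  ... | no _ = refl

  upper-ascent : ∀ w → Ascent w → upper w ≡ sw w
  upper-ascent w asc with ev w p <? ev w (suc p)
  ... | yes _ = refl
  ... | no ¬asc = ⊥-elim (¬asc asc)

  lifting : ∀ u v → Unique u → suc p ≤ length u → suc p ≤ length v → Ascent u → Ascent v →
    (u ≤A v) ⇔ (sw u ≤A sw v)
  lifting u v u-unique p+1≤∣u∣ p+1≤∣v∣ asc-u asc-v = mk⇔
    (λ u≤v → subst₂ _≤A_ (upper-ascent u asc-u) (upper-ascent v asc-v) (proj₂ (monotone u v u-unique p+1≤∣u∣ u≤v)))
    (λ su≤sv → subst₂ _≤A_ (lower-sw u p+1≤∣u∣ asc-u) (lower-sw v p+1≤∣v∣ asc-v)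
                 (proj₁ (monotone (sw u) (sw v) sw-unique (p+1≤∣sw∣ u p+1≤∣u∣) su≤sv)))
    where
    p+1≤∣sw∣ : ∀ w → suc p ≤ length w → suc p ≤ length (sw w)
    p+1≤∣sw∣ w = subst (suc p ≤_) (sym (length-swap w p (suc p)))
    lower-sw : ∀ w → suc p ≤ length w → Ascent w → lower (sw w) ≡ w
    lower-sw w p+1≤∣w∣ asc =
      trans (lower-descent (sw w) (sw-ascent (sw w) (p+1≤∣sw∣ w p+1≤∣w∣) (subst Ascent (sym (sw-involutive w p+1≤∣w∣)) asc)))
            (sw-involutive w p+1≤∣w∣)
    asc-u′ : Ascent (sw (sw u))
    asc-u′ = subst Ascent (sym (sw-involutive u p+1≤∣u∣)) asc-u
    asc-v′ : Ascent (sw (sw v))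
    asc-v′ = subst Ascent (sym (sw-involutive v p+1≤∣v∣)) asc-v
    sw-unique : Unique (sw u)
    sw-unique = Unique-↭ (↭-sym (swap<-↭ u p (suc p) 1≤p ≤-refl p+1≤∣u∣)) u-unique

≤A-cong : ∀ {x x′ y y′} → x ≡ x′ → y ≡ y′ → (x ≤A y) ⇔ (x′ ≤A y′)
≤A-cong refl refl = mk⇔ id id

length-snoc : ∀ (A : List ℕ) a → length (A ++ [ a ]) ≡ suc (length A)
length-snoc A a = trans (length-++ A) (+-comm (length A) 1)

adjacent-lifting : ∀ A a b B A′ a′ b′ B′ → length A ≡ length A′ → a < b → a′ < b′ →
  Unique (A ++ a ∷ b ∷ B) → Unique (A′ ++ a′ ∷ b′ ∷ B′) →
  ((A ++ a ∷ b ∷ B) ≤A (A′ ++ a′ ∷ b′ ∷ B′)) ⇔ ((A ++ b ∷ a ∷ B) ≤A (A′ ++ b′ ∷ a′ ∷ B′))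
adjacent-lifting A a b B A′ a′ b′ B′ ∣A∣≡∣A′∣ a<b a′<b′ u-unique _ =
  ≤A-cong (sw-cut A a b B) (subst (λ n → sw-at n v ≡ A′ ++ b′ ∷ a′ ∷ B′) (sym ∣A∣≡∣A′∣) (sw-cut A′ a′ b′ B′))
    ⇔-∘ lifting u v u-unique (p+1≤ A a b B) (subst (λ n → suc (suc n) ≤ length v) (sym ∣A∣≡∣A′∣) (p+1≤ A′ a′ b′ B′))
          (subst₂ _<_ (sym (ev-first A a b B)) (sym (ev-next A a b B)) a<b)
          (subst₂ _<_ (sym (subst (λ n → ev v (suc n) ≡ a′) (sym ∣A∣≡∣A′∣) (ev-first A′ a′ b′ B′)))
                      (sym (subst (λ n → ev v (suc (suc n)) ≡ b′) (sym ∣A∣≡∣A′∣) (ev-next A′ a′ b′ B′))) a′<b′)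
  where
  open Lifting (suc (length A)) (s≤s z≤n)
  u = A ++ a ∷ b ∷ B
  v = A′ ++ a′ ∷ b′ ∷ B′
  sw-at : ℕ → List ℕ → List ℕ
  sw-at n w = swap w (suc n) (suc (suc n))
  sw-cut : ∀ A (a : ℕ) b B → sw-at (length A) (A ++ a ∷ b ∷ B) ≡ A ++ b ∷ a ∷ B
  sw-cut A a b B = subst (λ n → swap (A ++ a ∷ b ∷ B) (suc (length A)) (suc n) ≡ A ++ b ∷ a ∷ B)
                         (length-snoc A a) (swap-exchanges A a [] b B)
  ev-first : ∀ A (a : ℕ) b B → ev (A ++ a ∷ b ∷ B) (suc (length A)) ≡ a
  ev-first A a b B = ev-at A a (b ∷ B)
  ev-next : ∀ A (a : ℕ) b B → ev (A ++ a ∷ b ∷ B) (suc (suc (length A))) ≡ b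
  ev-next A a b B = subst (λ n → ev (A ++ a ∷ b ∷ B) (suc n) ≡ b) (length-snoc A a) (ev-second A a [] b B)
  p+1≤ : ∀ A (a : ℕ) b B → suc (suc (length A)) ≤ length (A ++ a ∷ b ∷ B)
  p+1≤ A a b B = subst (λ n → suc n ≤ length (A ++ a ∷ b ∷ B)) (length-snoc A a) (second≤length A a [] b B)

-- Rotation: moving y in front of a block U of smaller letters is an order
-- isomorphism (for two words cut at the same places); it is a sequence of
-- adjacent liftings, each moving y past one letter of U.
rotation : ∀ P U y V P′ U′ y′ V′ → length P ≡ length P′ → length U ≡ length U′ → All (_< y) U → All (_< y′) U′ →
  Unique (P ++ U ++ y ∷ V) → Unique (P′ ++ U′ ++ y′ ∷ V′) →
  ((P ++ U ++ y ∷ V) ≤A (P′ ++ U′ ++ y′ ∷ V′)) ⇔ ((P ++ y ∷ U ++ V) ≤A (P′ ++ y′ ∷ U′ ++ V′))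
rotation P [] y V P′ [] y′ V′ _ _ _ _ _ _ = mk⇔ id id
rotation P (u ∷ U) y V P′ (u′ ∷ U′) y′ V′ ∣P∣≡ ∣U∣≡ (u<y ∷ U<y) (u′<y′ ∷ U′<y′) w-unique w′-unique =
  swap-past-u ⇔-∘ (≤A-cong (after P u y U V) (after P′ u′ y′ U′ V′)
              ⇔-∘ (rotate-U ⇔-∘ ≤A-cong (before P u U y V) (before P′ u′ U′ y′ V′)))
  where
  before : ∀ P (u : ℕ) U y V → P ++ (u ∷ U) ++ y ∷ V ≡ (P ++ [ u ]) ++ U ++ y ∷ V
  before P u U y V = sym (++-assoc P [ u ] (U ++ y ∷ V))
  after : ∀ P (u : ℕ) y U V → (P ++ [ u ]) ++ y ∷ U ++ V ≡ P ++ u ∷ y ∷ U ++ V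
  after P u y U V = ++-assoc P [ u ] (y ∷ U ++ V)
  moved-unique : ∀ P (u : ℕ) U y V → Unique (P ++ (u ∷ U) ++ y ∷ V) → Unique (P ++ u ∷ y ∷ U ++ V)
  moved-unique P u U y V = Unique-↭ (subst₂ _↭_ (sym (before P u U y V)) (after P u y U V) (++⁺ˡ (P ++ [ u ]) (shift y U V)))
  rotate-U = rotation (P ++ [ u ]) U y V (P′ ++ [ u′ ]) U′ y′ V′
    (trans (length-snoc P u) (trans (cong suc ∣P∣≡) (sym (length-snoc P′ u′)))) (suc-injective ∣U∣≡) U<y U′<y′
    (subst Unique (before P u U y V) w-unique) (subst Unique (before P′ u′ U′ y′ V′) w′-unique)
  swap-past-u = adjacent-lifting P u y (U ++ V) P′ u′ y′ (U′ ++ V′) ∣P∣≡ u<y u′<y′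
    (moved-unique P u U y V w-unique) (moved-unique P′ u′ U′ y′ V′ w′-unique)

oneTo-in-range : ∀ n → All (InRange n) (oneTo n)
oneTo-in-range n = AllP.map⁺ (applyUpTo⁺₁ id n (λ i<n → s≤s z≤n , i<n))

oneTo-unique : ∀ n → Unique (oneTo n)
oneTo-unique n = UniqueP.map⁺ suc-injective (UniqueP.upTo⁺ n)

Path : List ℕ → List ℕ → Set
Path π [] = ⊤
Path π (x ∷ []) = ⊤
Path π (x ∷ y ∷ r) = (ev π x ≡ y) × Path π (y ∷ r)

chain⇒path : ∀ π f x r → Chain π f (x ∷ r) → Path π ((x ∷ r) ++ [ f ])
chain⇒path π f x [] πx≡f = πx≡f , tt
chain⇒path π f x (y ∷ r) (πx≡y , chain) = πx≡y , chain⇒path π f y r chain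

path⇒chain : ∀ π f x r → Path π ((x ∷ r) ++ [ f ]) → Chain π f (x ∷ r)
path⇒chain π f x [] (πx≡f , _) = πx≡f
path⇒chain π f x (y ∷ r) (πx≡y , path) = πx≡y , path⇒chain π f y r path

path-split : ∀ π A x B → Path π (A ++ x ∷ B) → Path π (A ++ [ x ]) × Path π (x ∷ B)
path-split π [] x B path = tt , path
path-split π (a ∷ []) x B (πa≡x , path) = (πa≡x , tt) , path
path-split π (a ∷ a′ ∷ A) x B (πa≡a′ , path) with path-split π (a′ ∷ A) x B path
... | left , right = (πa≡a′ , left) , right

path-join : ∀ π A x B → Path π (A ++ [ x ]) → Path π (x ∷ B) → Path π (A ++ x ∷ B)
path-join π [] x B _ right = right
path-join π (a ∷ []) x B (πa≡x , _) right = πa≡x , right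
path-join π (a ∷ a′ ∷ A) x B (πa≡a′ , left) right = πa≡a′ , path-join π (a′ ∷ A) x B left right

-- Paths and cycles only depend on the values of π at their own entries
-- (the last entry of a path is not moved by it).
Agree : List ℕ → List ℕ → ℕ → Set
Agree π π′ z = ev π′ z ≡ ev π z

path-cong : ∀ π π′ A x → All (Agree π π′) A → Path π (A ++ [ x ]) → Path π′ (A ++ [ x ])
path-cong π π′ [] x _ _ = tt
path-cong π π′ (a ∷ []) x (agree ∷ _) (πa≡x , _) = trans agree πa≡x , tt
path-cong π π′ (a ∷ a′ ∷ A) x (agree ∷ agrees) (πa≡a′ , path) =
  trans agree πa≡a′ , path-cong π π′ (a′ ∷ A) x agrees path

chain-cong : ∀ π π′ f c → All (Agree π π′) c → Chain π f c → Chain π′ f c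
chain-cong π π′ f (x ∷ []) (agree ∷ _) πx≡f = trans agree πx≡f
chain-cong π π′ f (x ∷ y ∷ r) (agree ∷ agrees) (πx≡y , chain) = trans agree πx≡y , chain-cong π π′ f (y ∷ r) agrees chain

cycle-cong : ∀ π π′ c → All (Agree π π′) c → CycleOf π c → CycleOf π′ c
cycle-cong π π′ (x ∷ r) agrees (chain , x≤r) = chain-cong π π′ x (x ∷ r) agrees chain , x≤r

linked-suffix : ∀ A {B : List ℕ} → Linked _<_ (A ++ B) → Linked _<_ B
linked-suffix [] l = l
linked-suffix (a ∷ A) l = linked-suffix A (Linked.tail l)

linked-head< : ∀ {x : ℕ} B → Linked _<_ (x ∷ B) → All (x <_) B
linked-head< [] _ = []
linked-head< (b ∷ B) (x<b ∷ l) = LinkedP.Linked⇒All <-trans x<b l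

linked-before : ∀ U (y : ℕ) V → Linked _<_ (U ++ y ∷ V) → All (_< y) U
linked-before [] y V l = []
linked-before (u ∷ U) y V l = All.head (++⁻ʳ U (linked-head< (U ++ y ∷ V) l)) ∷ linked-before U y V (Linked.tail l)

linked-remove : ∀ A (y : ℕ) B → Linked _<_ (A ++ y ∷ B) → Linked _<_ (A ++ B)
linked-remove [] y [] l = []
linked-remove [] y (b ∷ B) l = Linked.tail l
linked-remove (a ∷ []) y [] l = [-]
linked-remove (a ∷ []) y (b ∷ B) (a<y ∷ y<b ∷ l) = <-trans a<y y<b ∷ l
linked-remove (a ∷ a′ ∷ A) y B (a<a′ ∷ l) = a<a′ ∷ linked-remove (a′ ∷ A) y B l

linked-insert : ∀ A (x : ℕ) U y V → Linked _<_ (A ++ x ∷ U ++ V) → x < y → All (_< y) U → All (y <_) V →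
  Linked _<_ (A ++ x ∷ U ++ y ∷ V)
linked-insert [] x [] y [] l x<y _ _ = x<y ∷ [-]
linked-insert [] x [] y (v ∷ V) l x<y _ (y<v ∷ _) = x<y ∷ y<v ∷ Linked.tail l
linked-insert [] x (u ∷ U) y V (x<u ∷ l) x<y (u<y ∷ U<y) y<V = x<u ∷ linked-insert [] u U y V l u<y U<y y<V
linked-insert (a ∷ []) x U y V (a<x ∷ l) x<y U<y y<V = a<x ∷ linked-insert [] x U y V l x<y U<y y<V
linked-insert (a ∷ a′ ∷ A) x U y V (a<a′ ∷ l) x<y U<y y<V = a<a′ ∷ linked-insert (a′ ∷ A) x U y V l x<y U<y y<V

linked-split : ∀ (X : List ℕ) y → Linked _<_ X → All (_≢ y) X →
  ∃ λ U → ∃ λ V → (X ≡ U ++ V) × All (_< y) U × All (y <_) V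
linked-split [] y _ _ = [] , [] , refl , [] , []
linked-split (x ∷ X) y l (x≢y ∷ X≢y) with x <? y
... | yes x<y with linked-split X y (Linked.tail l) X≢y
...   | U , V , refl , U<y , y<V = x ∷ U , V , refl , x<y ∷ U<y , y<V
linked-split (x ∷ X) y l (x≢y ∷ X≢y) | no x≮y = [] , x ∷ X , refl , [] , LinkedP.Linked⇒All <-trans y<x l
  where
  y<x : y < x
  y<x = ≤∧≢⇒< (≮⇒≥ x≮y) (x≢y ∘ sym)

Fixed : List ℕ → ℕ → Set
Fixed π x = ev π x ≡ x

-- A standard cyclic form of type α ++ k ∷ (m ones), cut into the cycles of
-- shape α, the distinguished cycle (h ∷ c) of length k, and the list X of the
-- m fixed points that follow; w is the resulting one-line word.
record CutForm (N : ℕ) (α : List ℕ) (k m : ℕ) (w : List ℕ) : Set where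
  constructor cut
  field
    π : List ℕ
    front : List (List ℕ)
    h : ℕ
    c : List ℕ
    X : List ℕ
    π-perm : IsPerm N π
    front-cycles : All (CycleOf π) front
    hc-cycle : CycleOf π (h ∷ c)
    X-fixed : All (Fixed π) X
    heads-increasing : Linked _<_ (heads front ++ h ∷ X)
    letters : concat front ++ (h ∷ c) ++ X ↭ oneTo (length π)
    front-type : map length front ≡ α
    hc-length : length (h ∷ c) ≡ k
    X-length : length X ≡ m
    word : w ≡ concat front ++ (h ∷ c) ++ X

single : ℕ → List ℕ
single x = x ∷ []

heads-++ : ∀ (A B : List (List ℕ)) → heads (A ++ B) ≡ heads A ++ heads B
heads-++ [] B = refl
heads-++ ([] ∷ A) B = heads-++ A B
heads-++ ((x ∷ c) ∷ A) B = cong (x ∷_) (heads-++ A B)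

heads-single : ∀ X → heads (map single X) ≡ X
heads-single [] = refl
heads-single (x ∷ X) = cong (x ∷_) (heads-single X)

concat-single : ∀ X → concat (map single X) ≡ X
concat-single [] = refl
concat-single (x ∷ X) = cong (x ∷_) (concat-single X)

cut-type : ∀ α (cs : List (List ℕ)) L → map length cs ≡ α ++ L →
  ∃ λ cs₁ → ∃ λ cs₂ → (cs ≡ cs₁ ++ cs₂) × (map length cs₁ ≡ α) × (map length cs₂ ≡ L)
cut-type [] cs L eq = [] , cs , refl , refl , eq
cut-type (a ∷ α) (c ∷ cs) L eq with cut-type α cs L (cong (Data.List.drop 1) eq)
... | cs₁ , cs₂ , refl , type₁ , type₂ = c ∷ cs₁ , cs₂ , refl , cong₂ _∷_ (∷-injectiveˡ eq) type₁ , type₂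

ones-singles : ∀ β (cs : List (List ℕ)) → All (_≡ 1) β → map length cs ≡ β →
  ∃ λ X → (cs ≡ map single X) × (length X ≡ length β)
ones-singles [] [] _ _ = [] , refl , refl
ones-singles (b ∷ β) ((x ∷ []) ∷ cs) (_ ∷ ones) eq with ones-singles β cs ones (cong (Data.List.drop 1) eq)
... | X , refl , ∣X∣ = x ∷ X , refl , cong suc ∣X∣
ones-singles (b ∷ β) ([] ∷ cs) (refl ∷ _) ()
ones-singles (b ∷ β) ((x ∷ y ∷ c) ∷ cs) (refl ∷ _) ()

singles-type : ∀ β X → All (_≡ 1) β → length X ≡ length β → map length (map single X) ≡ β
singles-type [] [] _ _ = refl
singles-type (b ∷ β) (x ∷ X) (refl ∷ ones) ∣X∣ = cong (1 ∷_) (singles-type β X ones (suc-injective ∣X∣))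

singles-fixed : ∀ π X → All (CycleOf π) (map single X) → All (Fixed π) X
singles-fixed π [] _ = []
singles-fixed π (x ∷ X) ((πx≡x , _) ∷ cycles) = πx≡x ∷ singles-fixed π X cycles

fixed-singles : ∀ π X → All (Fixed π) X → All (CycleOf π) (map single X)
fixed-singles π [] _ = []
fixed-singles π (x ∷ X) (πx≡x ∷ fixed) = (πx≡x , []) ∷ fixed-singles π X fixed

concat-cut : ∀ front h c X → concat (front ++ (h ∷ c) ∷ map single X) ≡ concat front ++ (h ∷ c) ++ X
concat-cut front h c X = trans (sym (concat-++ front _)) (cong (λ z → concat front ++ (h ∷ c) ++ z) (concat-single X))

heads-cut : ∀ front h c X → heads (front ++ (h ∷ c) ∷ map single X) ≡ heads front ++ h ∷ X
heads-cut front h c X = trans (heads-++ front _) (cong (λ z → heads front ++ h ∷ z) (heads-single X))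

cut-of-InC : ∀ α k β w → 1 ≤ k → All (_≡ 1) β → InC (α ++ k ∷ β) w → CutForm (sum (α ++ k ∷ β)) α k (length β) w
cut-of-InC α k β w 1≤k ones (π , cs , π-perm , (cycles , increasing , letters) , type , refl)
  with cut-type α cs (k ∷ β) type
... | cs₁ , [] ∷ cs₃ , refl , _ , type₂ = ⊥-elim (1+n≰n (subst (1 ≤_) (sym (∷-injectiveˡ type₂)) 1≤k))
... | cs₁ , (h ∷ c) ∷ cs₃ , refl , type₁ , type₂ with ones-singles β cs₃ ones (cong (Data.List.drop 1) type₂)
... | X , refl , ∣X∣ =
  cut π cs₁ h c X π-perm (++⁻ˡ cs₁ cycles) (All.head (++⁻ʳ cs₁ cycles)) (singles-fixed π X (All.tail (++⁻ʳ cs₁ cycles)))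
      (subst (Linked _<_) (heads-cut cs₁ h c X) increasing)
      (subst (_↭ oneTo (length π)) (concat-cut cs₁ h c X) letters) type₁ (∷-injectiveˡ type₂) ∣X∣
      (concat-cut cs₁ h c X)

InC-of-cut : ∀ α k β w N → All (_≡ 1) β → CutForm N α k (length β) w → N ≡ sum (α ++ k ∷ β) → InC (α ++ k ∷ β) w
InC-of-cut α k β w N ones (cut π front h c X π-perm front-cycles hc-cycle X-fixed increasing letters type ∣hc∣ ∣X∣ refl) refl =
  π , front ++ (h ∷ c) ∷ map single X , π-perm ,
  (++⁺ front-cycles (hc-cycle ∷ fixed-singles π X X-fixed) ,
   subst (Linked _<_) (sym (heads-cut front h c X)) increasing ,
   subst (_↭ oneTo (length π)) (sym (concat-cut front h c X)) letters) ,
  trans (map-++ length front _) (cong₂ _++_ type (cong₂ _∷_ ∣hc∣ (singles-type β X ones ∣X∣))) ,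
  concat-cut front h c X

last-split : ∀ (x : ℕ) r → ∃ λ c₀ → ∃ λ e → x ∷ r ≡ c₀ ++ [ e ]
last-split x [] = [] , x , refl
last-split x (y ∷ r) with last-split y r
... | c₀ , e , eq = x ∷ c₀ , e , cong (x ∷_) eq

-- Both surgeries on cut forms replace π by π′ = swap π e y, where e is the
-- last letter of the (possibly enlarged) cycle and y the letter moving
-- between the cycle and the fixed points.  Given the letters of the form as
-- Q ++ (c₀ ++ [ e ]) ++ U ++ y ∷ V, this module records that π′ agrees with π
-- away from e and y, so the untouched cycles and fixed points survive.
Avoids : ℕ → ℕ → ℕ → Set
Avoids e y z = (z ≢ e) × (z ≢ y)

module Surgery (π Q c₀ : List ℕ) (e : ℕ) (U : List ℕ) (y : ℕ) (V : List ℕ)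
               (letters : Q ++ (c₀ ++ [ e ]) ++ U ++ y ∷ V ↭ oneTo (length π)) where

  private
    K = (c₀ ++ [ e ]) ++ U ++ y ∷ V
    all-distinct : Unique (Q ++ K)
    all-distinct = Unique-↭ (↭-sym letters) (oneTo-unique (length π))
    K-distinct : Unique K
    K-distinct = unique-suffix Q all-distinct
    Uy-distinct : Unique (U ++ y ∷ V)
    Uy-distinct = unique-suffix (c₀ ++ [ e ]) K-distinct
    e∈K : e ∈ K
    e∈K = ∈-++⁺ˡ (∈-++⁺ʳ c₀ (here refl))
    y∈K : y ∈ K
    y∈K = ∈-++⁺ʳ (c₀ ++ [ e ]) (∈-++⁺ʳ U (here refl))
    e≠K : ∀ {z} → z ∈ U ++ y ∷ V → e ≢ z
    e≠K = unique-apart (c₀ ++ [ e ]) (U ++ y ∷ V) K-distinct (∈-++⁺ʳ c₀ (here refl))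
    in-range : ∀ {z} → z ∈ K → InRange (length π) z
    in-range z∈K = lookup (All-resp-↭ (↭-sym letters) (oneTo-in-range (length π))) (∈-++⁺ʳ Q z∈K)

  e≢y : e ≢ y
  e≢y = e≠K (∈-++⁺ʳ U (here refl))

  Q-avoids : All (Avoids e y) Q
  Q-avoids = tabulate λ z∈Q → unique-apart Q K all-distinct z∈Q e∈K , unique-apart Q K all-distinct z∈Q y∈K

  c₀-avoids : All (Avoids e y) c₀
  c₀-avoids = tabulate λ z∈c₀ →
    unique-apart c₀ [ e ] (unique-prefix (c₀ ++ [ e ]) _ K-distinct) z∈c₀ (here refl) ,
    unique-apart (c₀ ++ [ e ]) (U ++ y ∷ V) K-distinct (∈-++⁺ˡ z∈c₀) (∈-++⁺ʳ U (here refl))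

  UV-avoids : All (Avoids e y) (U ++ V)
  UV-avoids = tabulate avoids
    where
    avoids : ∀ {z} → z ∈ U ++ V → Avoids e y z
    avoids z∈UV with ∈-++⁻ U z∈UV
    ... | inj₁ z∈U = e≠K (∈-++⁺ˡ z∈U) ∘ sym , unique-apart U (y ∷ V) Uy-distinct z∈U (here refl)
    ... | inj₂ z∈V = e≠K (∈-++⁺ʳ U (there z∈V)) ∘ sym ,
                     λ z≡y → unique-apart [ y ] V (unique-suffix U Uy-distinct) (here refl) z∈V (sym z≡y)

  π′ : List ℕ
  π′ = swap π e y

  private
    ev-π′ : ∀ k → ev π′ k ≡ ev π (τ e y k)
    ev-π′ = ev-swap π e y (proj₁ (in-range e∈K)) (proj₂ (in-range e∈K)) (proj₁ (in-range y∈K)) (proj₂ (in-range y∈K))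

  π′-at-e : ev π′ e ≡ ev π y
  π′-at-e = trans (ev-π′ e) (cong (ev π) (τ-at-i e y))

  π′-at-y : ev π′ y ≡ ev π e
  π′-at-y = trans (ev-π′ y) (cong (ev π) (τ-at-j e y))

  π′-agrees : ∀ {l} → All (Avoids e y) l → All (Agree π π′) l
  π′-agrees = All.map λ (z≢e , z≢y) → trans (ev-π′ _) (cong (ev π) (τ-elsewhere e y _ z≢e z≢y))

  π′-perm : ∀ {N} → IsPerm N π → IsPerm N π′
  π′-perm = ↭-trans (swap-↭ π e y (proj₁ (in-range e∈K)) (proj₂ (in-range e∈K)) (proj₁ (in-range y∈K)) (proj₂ (in-range y∈K)))

  π′-length : length π′ ≡ length π
  π′-length = length-swap π e y

  front-cycles′ : ∀ {cs} → concat cs ≡ Q → All (CycleOf π) cs → All (CycleOf π′) cs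
  front-cycles′ refl = go (concat⁻ Q-avoids)
    where
    go : ∀ {cs} → All (All (Avoids e y)) cs → All (CycleOf π) cs → All (CycleOf π′) cs
    go [] [] = []
    go (avoids ∷ avoidss) (cycle ∷ cycles) = cycle-cong π π′ _ (π′-agrees avoids) cycle ∷ go avoidss cycles

  c₀-path′ : Path π (c₀ ++ [ e ]) → Path π′ (c₀ ++ [ e ])
  c₀-path′ = path-cong π π′ c₀ e (π′-agrees c₀-avoids)

  UV-fixed′ : All (Fixed π) (U ++ V) → All (Fixed π′) (U ++ V)
  UV-fixed′ fixed = go UV-avoids fixed
    where
    go : ∀ {l} → All (Avoids e y) l → All (Fixed π) l → All (Fixed π′) l
    go [] [] = []
    go (avoids ∷ avoidss) (πx≡x ∷ fixed) = trans (All.head (π′-agrees (avoids ∷ []))) πx≡x ∷ go avoidss fixed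

cycle-end↭fixed : ∀ Q hc (y : ℕ) U V → Q ++ (hc ++ [ y ]) ++ U ++ V ↭ Q ++ hc ++ U ++ y ∷ V
cycle-end↭fixed Q hc y U V =
  ++⁺ˡ Q (subst (_↭ hc ++ U ++ y ∷ V) (sym (++-assoc hc [ y ] (U ++ V))) (++⁺ˡ hc (↭-sym (shift y U V))))

path-end : ∀ c₀ (e y h : ℕ) → ((c₀ ++ [ e ]) ++ [ y ]) ++ [ h ] ≡ c₀ ++ e ∷ y ∷ [ h ]
path-end c₀ e y h = trans (++-assoc (c₀ ++ [ e ]) [ y ] [ h ]) (++-assoc c₀ [ e ] (y ∷ [ h ]))

-- Absorbing the fixed point y into the distinguished cycle as its new last
-- letter: the cycle h → … → e → h becomes h → … → e → y → h.
absorb : ∀ {N α k m w} → (F : CutForm N α k (suc m) w) → ∀ U y V → CutForm.X F ≡ U ++ y ∷ V →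
  CutForm N α (suc k) m (concat (CutForm.front F) ++ (CutForm.h F ∷ CutForm.c F ++ [ y ]) ++ U ++ V)
absorb {m = m} (cut π front h c X π-perm front-cycles hc-cycle X-fixed increasing letters type ∣hc∣ ∣X∣ _) U y V refl
  with last-split h c
... | c₀ , e , hc≡ =
  cut π′ front h (c ++ [ y ]) (U ++ V) (π′-perm π-perm) (front-cycles′ refl front-cycles) new-cycle (UV-fixed′ UV-fixed)
      increasing′ letters′ type (trans (length-snoc (h ∷ c) y) (cong suc ∣hc∣)) ∣UV∣ refl
  where
  Q = concat front
  open Surgery π Q c₀ e U y V (subst (λ z → Q ++ z ++ U ++ y ∷ V ↭ oneTo (length π)) hc≡ letters)
  πy≡y : ev π y ≡ y
  πy≡y = lookup X-fixed (∈-++⁺ʳ U (here refl))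
  old-path : Path π (c₀ ++ e ∷ [ h ])
  old-path = subst (Path π) (trans (cong (_++ [ h ]) hc≡) (++-assoc c₀ [ e ] [ h ])) (chain⇒path π h h c (proj₁ hc-cycle))
  πe≡h : ev π e ≡ h
  πe≡h = proj₁ (proj₂ (path-split π c₀ e [ h ] old-path))
  h<y : h < y
  h<y = All.head (++⁻ʳ U (linked-head< (U ++ y ∷ V) (linked-suffix (heads front) increasing)))
  new-path : Path π′ (c₀ ++ e ∷ y ∷ [ h ])
  new-path = path-join π′ c₀ e (y ∷ [ h ]) (c₀-path′ (proj₁ (path-split π c₀ e [ h ] old-path)))
                       (trans π′-at-e πy≡y , trans π′-at-y πe≡h , tt)
  new-cycle : CycleOf π′ (h ∷ c ++ [ y ])
  new-cycle =
    path⇒chain π′ h h (c ++ [ y ])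
      (subst (Path π′) (sym (trans (cong (λ z → (z ++ [ y ]) ++ [ h ]) hc≡) (path-end c₀ e y h))) new-path) ,
    ++⁺ (proj₂ hc-cycle) (<⇒≤ h<y ∷ [])
  UV-fixed : All (Fixed π) (U ++ V)
  UV-fixed = ++⁺ (++⁻ˡ U X-fixed) (All.tail (++⁻ʳ U X-fixed))
  increasing′ : Linked _<_ (heads front ++ h ∷ U ++ V)
  increasing′ = subst (Linked _<_) (++-assoc (heads front) (h ∷ U) V)
    (linked-remove (heads front ++ h ∷ U) y V (subst (Linked _<_) (sym (++-assoc (heads front) (h ∷ U) (y ∷ V))) increasing))
  letters′ : Q ++ (h ∷ c ++ [ y ]) ++ U ++ V ↭ oneTo (length π′)
  letters′ = ↭-trans (cycle-end↭fixed Q (h ∷ c) y U V)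
                     (subst (λ n → Q ++ (h ∷ c) ++ U ++ y ∷ V ↭ oneTo n) (sym π′-length) letters)
  ∣UV∣ : length (U ++ V) ≡ m
  ∣UV∣ = suc-injective (trans (cong suc (length-++ U)) (trans (sym (+-suc (length U) (length V))) (trans (sym (length-++ U)) ∣X∣)))

-- Releasing the last letter y of the distinguished cycle as a new fixed
-- point, inserted among the fixed points at its place U < y < V: the cycle
-- h → … → e → y → h becomes h → … → e → h.
release : ∀ {N α k m w} → (F : CutForm N α (suc k) m w) → ∀ c′ y U V → CutForm.c F ≡ c′ ++ [ y ] → CutForm.X F ≡ U ++ V →
  All (_< y) U → All (y <_) V → CutForm N α k (suc m) (concat (CutForm.front F) ++ (CutForm.h F ∷ c′) ++ U ++ y ∷ V)
release {m = m} (cut π front h c X π-perm front-cycles hc-cycle X-fixed increasing letters type ∣hc∣ ∣X∣ _)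
        c′ y U V refl refl U<y y<V
  with last-split h c′
... | c₀ , e , hc′≡ =
  cut π′ front h c′ (U ++ y ∷ V) (π′-perm π-perm) (front-cycles′ refl front-cycles) new-cycle UyV-fixed
      (linked-insert (heads front) h U y V increasing h<y U<y y<V) letters′ type
      (suc-injective (trans (sym (length-snoc (h ∷ c′) y)) ∣hc∣)) ∣UyV∣ refl
  where
  Q = concat front
  letters₀ : Q ++ (h ∷ c′) ++ U ++ y ∷ V ↭ oneTo (length π)
  letters₀ = ↭-trans (↭-sym (cycle-end↭fixed Q (h ∷ c′) y U V)) letters
  open Surgery π Q c₀ e U y V (subst (λ z → Q ++ z ++ U ++ y ∷ V ↭ oneTo (length π)) hc′≡ letters₀)
  old-path : Path π (c₀ ++ e ∷ y ∷ [ h ])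
  old-path = subst (Path π) (trans (cong (λ z → (z ++ [ y ]) ++ [ h ]) hc′≡) (path-end c₀ e y h))
               (chain⇒path π h h (c′ ++ [ y ]) (proj₁ hc-cycle))
  πe≡y : ev π e ≡ y
  πe≡y = proj₁ (proj₂ (path-split π c₀ e (y ∷ [ h ]) old-path))
  πy≡h : ev π y ≡ h
  πy≡h = proj₁ (proj₂ (proj₂ (path-split π c₀ e (y ∷ [ h ]) old-path)))
  new-cycle : CycleOf π′ (h ∷ c′)
  new-cycle =
    path⇒chain π′ h h c′
      (subst (Path π′) (sym (trans (cong (_++ [ h ]) hc′≡) (++-assoc c₀ [ e ] [ h ])))
        (path-join π′ c₀ e [ h ] (c₀-path′ (proj₁ (path-split π c₀ e (y ∷ [ h ]) old-path))) (trans π′-at-e πy≡h , tt))) ,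
    ++⁻ˡ c′ (proj₂ hc-cycle)
  UyV-fixed : All (Fixed π′) (U ++ y ∷ V)
  UyV-fixed = ++⁺ (++⁻ˡ U UV-fixed) (trans π′-at-y πe≡y ∷ ++⁻ʳ U UV-fixed)
    where
    UV-fixed = UV-fixed′ X-fixed
  h≢y : h ≢ y
  h≢y h≡y with ∈-++⁻ c₀ (subst (h ∈_) hc′≡ (here refl))
  ... | inj₁ h∈c₀ = proj₂ (lookup c₀-avoids h∈c₀) h≡y
  ... | inj₂ (here h≡e) = e≢y (trans (sym h≡e) h≡y)
  h<y : h < y
  h<y = ≤∧≢⇒< (All.head (++⁻ʳ c′ (proj₂ hc-cycle))) h≢y
  letters′ : Q ++ (h ∷ c′) ++ U ++ y ∷ V ↭ oneTo (length π′)
  letters′ = subst (λ n → Q ++ (h ∷ c′) ++ U ++ y ∷ V ↭ oneTo n) (sym π′-length) letters₀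
  ∣UyV∣ : length (U ++ y ∷ V) ≡ suc m
  ∣UyV∣ = trans (length-++ U) (trans (+-suc (length U) (length V)) (cong suc (trans (sym (length-++ U)) ∣X∣)))

iterSwap-rotates : ∀ P U (y : ℕ) V i → length U ≡ i → iterSwap (suc (length P)) (P ++ U ++ y ∷ V) i ≡ P ++ y ∷ U ++ V
iterSwap-rotates P [] y V zero _ = refl
iterSwap-rotates P (x ∷ r) y V (suc i) ∣U∣ with last-split x r
... | U′ , u , x∷r≡ = subst (λ U → iterSwap t (P ++ U ++ y ∷ V) (suc i) ≡ P ++ y ∷ U ++ V) (sym x∷r≡) (begin
  iterSwap t (P ++ (U′ ++ [ u ]) ++ y ∷ V) (suc i)
    ≡⟨ cong (λ z → swap (iterSwap t (P ++ z) i) t (t + suc i)) (++-assoc U′ [ u ] (y ∷ V)) ⟩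
  swap (iterSwap t (P ++ U′ ++ u ∷ y ∷ V) i) t (t + suc i)
    ≡⟨ cong (λ z → swap z t (t + suc i)) (iterSwap-rotates P U′ u (y ∷ V) i ∣U′∣) ⟩
  swap (P ++ u ∷ U′ ++ y ∷ V) t (t + suc i)
    ≡⟨ cong (swap (P ++ u ∷ U′ ++ y ∷ V) t) position ⟩
  swap (P ++ u ∷ U′ ++ y ∷ V) t (suc (length (P ++ u ∷ U′)))
    ≡⟨ swap-exchanges P u U′ y V ⟩
  P ++ y ∷ U′ ++ u ∷ V
    ≡⟨ cong (λ z → P ++ y ∷ z) (sym (++-assoc U′ [ u ] V)) ⟩
  P ++ y ∷ (U′ ++ [ u ]) ++ V ∎)
  where
  open ≡-Reasoning
  t = suc (length P)
  ∣U′∣ : length U′ ≡ i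
  ∣U′∣ = suc-injective (trans (sym (length-snoc U′ u)) (trans (cong length (sym x∷r≡)) ∣U∣))
  position : t + suc i ≡ suc (length (P ++ u ∷ U′))
  position = cong suc (trans (cong (λ z → length P + suc z) (sym ∣U′∣)) (sym (length-++ P)))

length-iterSwap : ∀ t w i → length (iterSwap t w i) ≡ length w
length-iterSwap t w zero = refl
length-iterSwap t w (suc i) = trans (length-swap (iterSwap t w i) t (t + suc i)) (length-iterSwap t w i)

-- Each swap is an involution, so π ↦ π^(i) is injective on words of a common length.
iterSwap-injective : ∀ t i w w′ → 1 ≤ t → t + i ≤ length w → length w ≡ length w′ →
  iterSwap t w i ≡ iterSwap t w′ i → w ≡ w′
iterSwap-injective t zero w w′ _ _ _ eq = eq
iterSwap-injective t (suc i) w w′ 1≤t t+i≤∣w∣ ∣w∣≡ eq =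
  iterSwap-injective t i w w′ 1≤t (≤-trans (+-monoʳ-≤ t (n≤1+n i)) t+i≤∣w∣) ∣w∣≡
    (trans (sym (undo w refl)) (trans (cong (λ z → swap z t (t + suc i)) eq) (undo w′ ∣w∣≡)))
  where
  undo : ∀ v → length w ≡ length v → swap (swap (iterSwap t v i) t (t + suc i)) t (t + suc i) ≡ iterSwap t v i
  undo v ∣w∣≡∣v∣ =
    swap-involutive (iterSwap t v i) t (t + suc i) 1≤t (≤-trans (m≤m+n t (suc i)) inside) (≤-trans 1≤t (m≤m+n t (suc i))) inside
    where
    inside : t + suc i ≤ length (iterSwap t v i)
    inside = subst (t + suc i ≤_) (trans ∣w∣≡∣v∣ (sym (length-iterSwap t v i))) t+i≤∣w∣

length-concat : ∀ (css : List (List ℕ)) → length (concat css) ≡ sum (map length css)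
length-concat [] = refl
length-concat (c ∷ css) = trans (length-++ c) (cong (length c +_) (length-concat css))

ones-of-bounds : ∀ β → All (0 <_) β → All (_≤ 1) β → All (_≡ 1) β
ones-of-bounds [] [] [] = []
ones-of-bounds (b ∷ β) (0<b ∷ pos) (b≤1 ∷ bounded) = ≤-antisym b≤1 0<b ∷ ones-of-bounds β pos bounded

module Decomposition (α : List ℕ) (a′ : ℕ) (β : List ℕ) (ones : All (_≡ 1) β) where

  a = suc (suc a′)
  st = ST α a β
  t = sum α + a
  N = sum (α ++ a ∷ β)

  sum-ST : sum st ≡ N
  sum-ST = trans (sum-++ α (suc a′ ∷ 1 ∷ β)) (trans (cong (λ z → sum α + suc z) (+-suc a′ (sum β))) (sym (sum-++ α (a ∷ β))))

  position-t : ∀ front (hc : List ℕ) → map length front ≡ α → length hc ≡ suc a′ → suc (length (concat front ++ hc)) ≡ t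
  position-t front hc type ∣hc∣ =
    trans (cong suc (trans (length-++ (concat front)) (cong₂ _+_ (trans (length-concat front) (cong sum type)) ∣hc∣)))
          (sym (+-suc (sum α) (suc a′)))

  CutST : List ℕ → Set
  CutST = CutForm (sum st) α (suc a′) (suc (length β))

  cut-of-ST : ∀ w → InC st w → CutST w
  cut-of-ST w = cut-of-InC α (suc a′) (1 ∷ β) w (s≤s z≤n) (refl ∷ ones)

  -- π^(i) moves the fixed point at position t + i to the end of the cycle
  -- of length 1 + a′, i.e. it is the word of the form obtained by absorb.
  rotate-fixed-point : ∀ front h c U y V i → map length front ≡ α → length (h ∷ c) ≡ suc a′ → length U ≡ i →
    iterSwap t (concat front ++ (h ∷ c) ++ U ++ y ∷ V) i ≡ concat front ++ (h ∷ c ++ [ y ]) ++ U ++ V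
  rotate-fixed-point front h c U y V i type ∣hc∣ ∣U∣ = begin
    iterSwap t (Q ++ (h ∷ c) ++ U ++ y ∷ V) i
      ≡⟨ cong₂ (λ s v → iterSwap s v i) (sym (position-t front (h ∷ c) type ∣hc∣)) (sym (++-assoc Q (h ∷ c) (U ++ y ∷ V))) ⟩
    iterSwap (suc (length (Q ++ h ∷ c))) ((Q ++ h ∷ c) ++ U ++ y ∷ V) i
      ≡⟨ iterSwap-rotates (Q ++ h ∷ c) U y V i ∣U∣ ⟩
    (Q ++ h ∷ c) ++ y ∷ U ++ V
      ≡⟨ trans (++-assoc Q (h ∷ c) (y ∷ U ++ V)) (cong (Q ++_) (sym (++-assoc (h ∷ c) [ y ] (U ++ V)))) ⟩
    Q ++ (h ∷ c ++ [ y ]) ++ U ++ V ∎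
    where
    open ≡-Reasoning
    Q = concat front

  rotated-in-Cλ : ∀ i → i ≤ length β → ∀ π → CutST π → InC (α ++ a ∷ β) (iterSwap t π i)
  rotated-in-Cλ i i≤ π F@(cut _ front h c X _ _ _ _ _ _ type ∣hc∣ ∣X∣ refl) with split-at X i (subst (i <_) (sym ∣X∣) (s≤s i≤))
  ... | U , y , V , refl , ∣U∣ =
    InC-of-cut α a β _ (sum st) ones
      (subst (CutForm (sum st) α a (length β)) (sym (rotate-fixed-point front h c U y V i type ∣hc∣ ∣U∣)) (absorb F U y V refl))
      sum-ST

  record RotationSite (i : ℕ) (w : List ℕ) : Set where
    constructor site
    field
      P U : List ℕ
      z : ℕ
      V : List ℕ
      shape : w ≡ P ++ U ++ z ∷ V
      P-length : suc (length P) ≡ t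
      U-length : length U ≡ i
      U<z : All (_< z) U
      distinct : Unique w
      w-length : length w ≡ sum st

  site-of-ST : ∀ i → i ≤ length β → ∀ w → InC st w → RotationSite i w
  site-of-ST i i≤ w w∈ with cut-of-ST w w∈
  ... | cut π front h c X π-perm _ _ _ increasing letters type ∣hc∣ ∣X∣ refl with split-at X i (subst (i <_) (sym ∣X∣) (s≤s i≤))
  ... | U , y , V , refl , ∣U∣ =
    site (concat front ++ (h ∷ c)) U y V (sym (++-assoc (concat front) (h ∷ c) (U ++ y ∷ V))) (position-t front (h ∷ c) type ∣hc∣) ∣U∣
         (linked-before U y V (Linked.tail (linked-suffix (heads front) increasing)))
         (Unique-↭ (↭-sym letters) (oneTo-unique (length π)))
         (trans (↭-length letters) (trans (length-oneTo (length π)) (trans (↭-length π-perm) (length-oneTo (sum st)))))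

  rotate-site : ∀ i w → (s : RotationSite i w) →
    iterSwap t w i ≡ RotationSite.P s ++ RotationSite.z s ∷ RotationSite.U s ++ RotationSite.V s
  rotate-site i w (site P U z V refl at-t ∣U∣ _ _ _) =
    subst (λ s → iterSwap s (P ++ U ++ z ∷ V) i ≡ P ++ z ∷ U ++ V) at-t (iterSwap-rotates P U z V i ∣U∣)

  inclusion : ∀ i → i ≤ length β → ∀ w → InCi st t i w → InC (α ++ a ∷ β) w
  inclusion i i≤ w (π , π∈ , refl) = rotated-in-Cλ i i≤ π (cut-of-ST π π∈)

  rotation-≤B : ∀ i → i ≤ length β → ∀ x y → InC st x → InC st y →
    (x ≤B y → iterSwap t x i ≤B iterSwap t y i) × (iterSwap t x i ≤B iterSwap t y i → x ≤B y)
  rotation-≤B i i≤ x y x∈ y∈ with site-of-ST i i≤ x x∈ | site-of-ST i i≤ y y∈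
  ... | sx@(site P U z V refl ∣P∣ ∣U∣ U<z x-distinct _) | sy@(site P′ U′ z′ V′ refl ∣P′∣ ∣U′∣ U′<z′ y-distinct _) =
    (λ x≤y → subst₂ _≤B_ (sym x-rotated) (sym y-rotated) (≤A⇒≤B rotated-distinct (Equivalence.to rotate (≤B⇒≤A x≤y)))) ,
    (λ rx≤ry → ≤A⇒≤B x-distinct (Equivalence.from rotate (subst₂ _≤A_ x-rotated y-rotated (≤B⇒≤A rx≤ry))))
    where
    x-rotated = rotate-site i _ sx
    y-rotated = rotate-site i _ sy
    rotate = rotation P U z V P′ U′ z′ V′ (suc-injective (trans ∣P∣ (sym ∣P′∣))) (trans ∣U∣ (sym ∣U′∣))
                      U<z U′<z′ x-distinct y-distinct
    rotated-distinct : Unique (P ++ z ∷ U ++ V)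
    rotated-distinct = Unique-↭ (++⁺ˡ P (shift z U V)) x-distinct

  isomorphism : ∀ i → i ≤ length β → BruhatIso (InC st) (InCi st t i)
  isomorphism i i≤ =
    (λ w → iterSwap t w i) ,
    (λ x x∈ → x , x∈ , refl) ,
    (λ x y x∈ y∈ → iterSwap-injective t i x y (≤-trans (s≤s z≤n) (m≤n+m a (sum α))) (room x x∈) (same-length x y x∈ y∈)) ,
    (λ y (x , x∈ , eq) → x , x∈ , eq) ,
    rotation-≤B i i≤
    where
    room : ∀ x → InC st x → t + i ≤ length x
    room x x∈ with site-of-ST i i≤ x x∈
    ... | site P U z V refl at-t refl _ _ _ =
      subst₂ (λ s n → s + length U ≤ n) at-t (sym (trans (length-++ P) (cong (length P +_) (length-++ U))))
            (≤-trans (m≤m+n _ (length V)) (≤-reflexive (regroup (length P) (length U) (length V))))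
      where
      regroup : ∀ p u v → suc p + u + v ≡ p + (u + suc v)
      regroup = solve-∀
    same-length : ∀ x y → InC st x → InC st y → length x ≡ length y
    same-length x y x∈ y∈ = trans (RotationSite.w-length (site-of-ST i i≤ x x∈)) (sym (RotationSite.w-length (site-of-ST i i≤ y y∈)))

  -- Every w ∈ C_λ arises: release the last letter y of its cycle of length a;
  -- if it lands after i fixed points, then w = π^(i).
  covering : ∀ w → InC (α ++ a ∷ β) w → Σ ℕ λ i → i ≤ length β × InCi st t i w
  covering w w∈ with cut-of-InC α a β w (s≤s z≤n) ones w∈
  ... | F@(cut π front h (x ∷ r) X _ _ _ _ increasing letters type ∣hc∣ ∣X∣ refl) with last-split x r
  ... | c′ , y , x∷r≡ with linked-split X y (Linked.tail (linked-suffix (heads front) increasing)) (X-avoids-y c′ y x∷r≡)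
    where
    X-avoids-y : ∀ c′ y → x ∷ r ≡ c′ ++ [ y ] → All (_≢ y) X
    X-avoids-y c′ y x∷r≡ = tabulate λ x′∈X x′≡y →
      unique-apart (h ∷ x ∷ r) X (unique-suffix (concat front) (Unique-↭ (↭-sym letters) (oneTo-unique (length π))))
        (there (subst (y ∈_) (sym x∷r≡) (∈-++⁺ʳ c′ (here refl)))) x′∈X (sym x′≡y)
  ... | U , V , refl , U<y , y<V =
    length U , ∣U∣≤ , π₀ ,
    InC-of-cut α (suc a′) (1 ∷ β) π₀ N (refl ∷ ones) (release F c′ y U V x∷r≡ refl U<y y<V) (sym sum-ST) , rotated
    where
    Q = concat front
    π₀ = Q ++ (h ∷ c′) ++ U ++ y ∷ V
    ∣U∣≤ : length U ≤ length β
    ∣U∣≤ = subst (length U ≤_) (trans (sym (length-++ U)) ∣X∣) (m≤m+n (length U) (length V))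
    ∣hc′∣ : length (h ∷ c′) ≡ suc a′
    ∣hc′∣ = suc-injective (trans (sym (length-snoc (h ∷ c′) y)) (trans (cong (λ z → length (h ∷ z)) (sym x∷r≡)) ∣hc∣))
    rotated : iterSwap t π₀ (length U) ≡ Q ++ (h ∷ x ∷ r) ++ U ++ V
    rotated = trans (rotate-fixed-point front h c′ U y V (length U) type ∣hc′∣ refl)
                    (cong (λ z → Q ++ (h ∷ z) ++ U ++ V) (sym x∷r≡))

mainTheorem6 : (α : List ℕ) (a : ℕ) (β : List ℕ) →
    All (0 <_) α → 1 < a → All (0 <_) β → All (_≤ 1) β →
    let λ′ = α ++ a ∷ β
        st = ST α a β
        t = sum α + a
    in (∀ w → InC st w → InC λ′ w)
       × (∀ i → i ≤ length β →
            (∀ w → InCi st t i w → InC λ′ w) × BruhatIso (InC st) (InCi st t i))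
       × (∀ w → InC λ′ w → Σ ℕ λ i → i ≤ length β × InCi st t i w)
mainTheorem6 α (suc (suc a′)) β _ (s≤s (s≤s z≤n)) β-positive β-bounded =
  (λ w w∈ → inclusion 0 z≤n w (w , w∈ , refl)) ,
  (λ i i≤ → inclusion i i≤ , isomorphism i i≤) ,
  covering
  where
  open Decomposition α a′ β (ones-of-bounds β β-positive β-bounded)
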